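{- Let $\mathscr{P}_{T_{\mathrm{II}}}$ be the set of partitions $\lambda_1\ge\lambda_2\ge\cdots\ge\lambda_\ell\ge1$ (empty partition included) with $\lambda_i-\lambda_{i+2}\ge 3$ for all applicable $i$, and such that $\lambda_i-\lambda_{i+1}\le 1$ implies $\lambda_i+\lambda_{i+1}\equiv 2\pmod 3$. Let $G(x)=G(x,q)=\sum_{\lambda}x^{\sharp(\lambda)}q^{|\lambda|}$ over those $\lambda\in\mathscr{P}_{T_{\mathrm{II}}}$ in which the part $1$ appears at most once (empty partition included), where $\sharp(\lambda)$ is the number of parts and $|\lambda|$ the sum of parts. Then $$p_0(x,q)G(x)+p_3(x,q)G(xq^3)+p_6(x,q)G(xq^6)+p_9(x,q)G(xq^9)=0,$$ where \begin{align*} p_0&=1+x(q^4+q^8),\\ p_3&=-1-x(q+q^2+q^3+q^4+q^8)-x^2(q^4+2q^5+q^6+q^8+q^9+q^{10}+q^{11})-x^3(q^9+q^{12}+q^{13}+q^{16}),\\ p_6&=x^3(-q^{12}+q^{13}+q^{14}+q^{15})+x^4(-q^{13}+q^{15}+q^{16}+q^{19}+q^{20}+q^{21}+q^{22})+x^5(q^{23}+q^{27}),\\ p_9&=x^5q^{29}+x^6(q^{30}+q^{34}). \end{align*} -}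

module Defs where

open import Data.Nat as ℕ using (ℕ; zero; suc; _≤_; _≤?_; _≟_; _%_)
open import Data.Integer as ℤ using (ℤ; +_; -_)
open import Data.List using (List; []; _∷_; length; filter; map; concatMap; upTo)
open import Data.Nat.ListAction using (sum)
open import Data.List.Relation.Unary.All using (All)
import Data.List.Relation.Unary.All as All
open import Data.Product using (_×_; _,_)
open import Data.Unit using (⊤; tt)
open import Relation.Nullary using (Dec; yes)
open import Relation.Nullary.Decidable.Core using (_×-dec_; _→-dec_)
open import Relation.Binary.PropositionalEquality using (_≡_)

-- Partitions are represented as lists of parts λ₁ ∷ λ₂ ∷ … ∷ λ_ℓ ∷ [].

AdjCond : List ℕ → Set
AdjCond (a ∷ b ∷ rest) =
  (b ≤ a) × ((a ℕ.≤ b ℕ.+ 1 → (a ℕ.+ b) % 3 ≡ 2) × AdjCond (b ∷ rest))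
AdjCond _ = ⊤

Gap2Cond : List ℕ → Set
Gap2Cond (a ∷ b ∷ c ∷ rest) = (c ℕ.+ 3 ≤ a) × Gap2Cond (b ∷ c ∷ rest)
Gap2Cond _ = ⊤

ones : List ℕ → ℕ
ones λs = length (filter (_≟ 1) λs)

Admissible : ℕ → List ℕ → Set
Admissible m λs =
  All (1 ≤_) λs × (sum λs ≡ m × (AdjCond λs × (Gap2Cond λs × ones λs ≤ 1)))

adj? : (λs : List ℕ) → Dec (AdjCond λs)
adj? (a ∷ b ∷ rest) = (b ≤? a) ×-dec (((a ≤? b ℕ.+ 1) →-dec ((a ℕ.+ b) % 3 ≟ 2)) ×-dec adj? (b ∷ rest))
adj? (_ ∷ []) = yes tt
adj? [] = yes tt

gap2? : (λs : List ℕ) → Dec (Gap2Cond λs)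
gap2? (a ∷ b ∷ c ∷ rest) = (c ℕ.+ 3 ≤? a) ×-dec gap2? (b ∷ c ∷ rest)
gap2? (_ ∷ _ ∷ []) = yes tt
gap2? (_ ∷ []) = yes tt
gap2? [] = yes tt

admissible? : (m : ℕ) (λs : List ℕ) → Dec (Admissible m λs)
admissible? m λs =
  All.all? (1 ≤?_) λs ×-dec ((sum λs ≟ m) ×-dec (adj? λs ×-dec (gap2? λs ×-dec (ones λs ≤? 1))))

lists : ℕ → ℕ → List (List ℕ)
lists zero m = [] ∷ []
lists (suc n) m = concatMap (λ a → map (a ∷_) (lists n m)) (map suc (upTo m))

-- g n m = coefficient of x^n q^m in G(x,q): the number of admissible
-- partitions of m with exactly n parts (every part of such a partition is ≤ m)
g : ℕ → ℕ → ℕ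
g n m = length (filter (admissible? m) (lists n m))

-- coefficient of x^i q^j in G(x q^k)  (= g i (j - k i), or 0 if j < k i)
gShift : ℕ → ℕ → ℕ → ℤ
gShift k i j with k ℕ.* i ≤? j
... | yes _ = + g i (j ℕ.∸ k ℕ.* i)
... | _     = + 0

-- a polynomial in x, q with integer coefficients: list of monomials c·x^a·q^b
Poly : Set
Poly = List (ℤ × ℕ × ℕ)

-- coefficient of x^n q^m in p(x,q) · G(x q^k)
coeffMul : Poly → ℕ → ℕ → ℕ → ℤ
coeffMul [] k n m = + 0
coeffMul ((c , a , b) ∷ p) k n m with a ≤? n | b ≤? m
... | yes _ | yes _ = c ℤ.* gShift k (n ℕ.∸ a) (m ℕ.∸ b) ℤ.+ coeffMul p k n m
... | _     | _     = coeffMul p k n m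

_x^_q^_ : ℤ → ℕ → ℕ → ℤ × ℕ × ℕ
c x^ a q^ b = c , a , b
infix 6 _x^_q^_

p₀ : Poly
p₀ = (+ 1) x^ 0 q^ 0 ∷ (+ 1) x^ 1 q^ 4 ∷ (+ 1) x^ 1 q^ 8 ∷ []

p₃ : Poly
p₃ = (- + 1) x^ 0 q^ 0
   ∷ (- + 1) x^ 1 q^ 1 ∷ (- + 1) x^ 1 q^ 2 ∷ (- + 1) x^ 1 q^ 3 ∷ (- + 1) x^ 1 q^ 4 ∷ (- + 1) x^ 1 q^ 8
   ∷ (- + 1) x^ 2 q^ 4 ∷ (- + 2) x^ 2 q^ 5 ∷ (- + 1) x^ 2 q^ 6 ∷ (- + 1) x^ 2 q^ 8
   ∷ (- + 1) x^ 2 q^ 9 ∷ (- + 1) x^ 2 q^ 10 ∷ (- + 1) x^ 2 q^ 11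
   ∷ (- + 1) x^ 3 q^ 9 ∷ (- + 1) x^ 3 q^ 12 ∷ (- + 1) x^ 3 q^ 13 ∷ (- + 1) x^ 3 q^ 16
   ∷ []

p₆ : Poly
p₆ = (- + 1) x^ 3 q^ 12 ∷ (+ 1) x^ 3 q^ 13 ∷ (+ 1) x^ 3 q^ 14 ∷ (+ 1) x^ 3 q^ 15
   ∷ (- + 1) x^ 4 q^ 13 ∷ (+ 1) x^ 4 q^ 15 ∷ (+ 1) x^ 4 q^ 16 ∷ (+ 1) x^ 4 q^ 19
   ∷ (+ 1) x^ 4 q^ 20 ∷ (+ 1) x^ 4 q^ 21 ∷ (+ 1) x^ 4 q^ 22
   ∷ (+ 1) x^ 5 q^ 23 ∷ (+ 1) x^ 5 q^ 27
   ∷ []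

p₉ : Poly
p₉ = (+ 1) x^ 5 q^ 29 ∷ (+ 1) x^ 6 q^ 30 ∷ (+ 1) x^ 6 q^ 34 ∷ []

-- coefficient of x^n q^m in p₀ G(x) + p₃ G(xq³) + p₆ G(xq⁶) + p₉ G(xq⁹)
lhsCoeff : ℕ → ℕ → ℤ
lhsCoeff n m =
  coeffMul p₀ 0 n m ℤ.+ coeffMul p₃ 3 n m ℤ.+ coeffMul p₆ 6 n m ℤ.+ coeffMul p₉ 9 n m

module Submission where

-- Built from its smallest part upwards, a partition in 𝒫_{T_II} only ever compares a new part
-- with the two parts below it.  F n m y z counts the n-part partitions of m built in this way
-- on top of two virtual parts y, z (Counting); shifting all parts by 3 and starting from the
-- virtual parts 2, 1 (i.e. -1, -2) gives exactly the partitions counted by G, so that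
-- G(x) = 𝔽_{2,1}(x q⁻³) for 𝔽_{y,z} = Σ F n m y z xⁿ qᵐ (Enumeration).  These series satisfy
-- spike relations 𝔽_{y,z} = Σ_{c ∈ L} x q^c 𝔽_{c,y} + 𝔽_{y′,z′}, where L lists the smallest parts
-- allowed above (y, z) but not above (y′, z′), confirmed by a finite evaluation (Relations), and
-- the shift relation 𝔽_{y+3,z+3}(x) = 𝔽_{y,z}(x q³) (Identities).  Series are represented as
-- ℤ-combinations of atoms x^a q^b 𝔽_{y,z}(x q^{3j}) with a sound cancellation test (Series).
-- The left-hand side of the theorem, rewritten in terms of 𝔽_{2,1}, is minus an explicit
-- combination of 18 relations with multipliers in x, q and x ↦ x q³, which the test confirms
-- (Certificate); reading off coefficients gives the statement (Coefficients).

module Counting where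
  open import Data.Nat using (ℕ; zero; suc; _+_; _*_; _∸_; _≤_; _<_; _<ᵇ_; _≡ᵇ_; _%_; z≤n; s≤s)
  open import Data.Nat.Properties
    using (≤-refl; ≤-trans; ≤-pred; m≤m+n; m≤n⇒m≤1+n; +-monoʳ-<; +-monoˡ-≤; +-identityʳ; +-suc; +-assoc; +-comm;
           +-cancelʳ-<; <-≤-trans; m∸n+n≡m; +-∸-assoc; *-suc; ≡ᵇ⇒≡)
  open import Data.Bool using (Bool; true; false; _∧_; if_then_else_)
  open import Data.Bool.Properties using (T-≡)
  open import Data.Nat.Tactic.RingSolver using (solve-∀)
  open import Data.Product using (_×_; _,_)
  open import Function.Bundles using (Equivalence)
  open import Relation.Binary.PropositionalEquality

  ∧-split : ∀ x {y} → x ∧ y ≡ true → x ≡ true × y ≡ true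
  ∧-split true p = refl , p

  ∧-join : ∀ {x y} → x ≡ true → y ≡ true → x ∧ y ≡ true
  ∧-join refl refl = refl

  true≢false : true ≢ false
  true≢false ()

  ≡ᵇ-true⇒≡ : ∀ {m n} → (m ≡ᵇ n) ≡ true → m ≡ n
  ≡ᵇ-true⇒≡ {m} {n} e = ≡ᵇ⇒≡ m n (Equivalence.from T-≡ e)

  -- `m ≤ n` decided as `m <ᵇ suc n`.  Unlike `_≤ᵇ_` this reduces definitionally
  -- when 3 is added to both arguments, which the shift invariance of F uses.
  leq : ℕ → ℕ → Bool
  leq m n = m <ᵇ suc n

  leq⇒≤ : ∀ m n → leq m n ≡ true → m ≤ n
  leq⇒≤ zero    n       _ = z≤n
  leq⇒≤ (suc m) (suc n) p = s≤s (leq⇒≤ m n p)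

  ≤⇒leq : ∀ {m n} → m ≤ n → leq m n ≡ true
  ≤⇒leq z≤n     = refl
  ≤⇒leq (s≤s p) = ≤⇒leq p

  >⇒leq-false : ∀ {m n} → n < m → leq m n ≡ false
  >⇒leq-false {suc m} {zero}  _       = refl
  >⇒leq-false {suc m} {suc n} (s≤s p) = >⇒leq-false p

  -- A part a may sit directly above the part y when  a ≤ y + 1 ⇒ a + y ≡ 2 (mod 3);
  -- the residue is computed from a % 3 and y % 3 so that it is invariant under a, y ↦ a + 3, y + 3.
  adjacentOK : ℕ → ℕ → Bool
  adjacentOK a y = if leq a (suc y) then (a % 3 + y % 3) % 3 ≡ᵇ 2 else true

  fits : ℕ → ℕ → ℕ → Bool
  fits a y z = leq (3 + z) a ∧ (leq y a ∧ adjacentOK a y)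

  fits⇒3≤ : ∀ a y z → fits a y z ≡ true → 3 ≤ a
  fits⇒3≤ a y z p with ∧-split (leq (3 + z) a) p
  ... | gap , _ = ≤-trans (m≤m+n 3 z) (leq⇒≤ (3 + z) a gap)

  sumBelow : ℕ → (ℕ → ℕ) → ℕ
  sumBelow zero    f = 0
  sumBelow (suc k) f = sumBelow k f + f k

  sumBelow-cong : ∀ k {f g : ℕ → ℕ} → (∀ i → i < k → f i ≡ g i) → sumBelow k f ≡ sumBelow k g
  sumBelow-cong zero    eq = refl
  sumBelow-cong (suc k) eq = cong₂ _+_ (sumBelow-cong k (λ i i<k → eq i (m≤n⇒m≤1+n i<k))) (eq k ≤-refl)

  sumBelow-zero : ∀ k {f : ℕ → ℕ} → (∀ i → i < k → f i ≡ 0) → sumBelow k f ≡ 0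
  sumBelow-zero zero    eq = refl
  sumBelow-zero (suc k) eq = cong₂ _+_ (sumBelow-zero k (λ i i<k → eq i (m≤n⇒m≤1+n i<k))) (eq k ≤-refl)

  sumBelow-front : ∀ k f → sumBelow (suc k) f ≡ f 0 + sumBelow k (λ i → f (suc i))
  sumBelow-front zero    f = +-comm 0 (f 0)
  sumBelow-front (suc k) f = trans (cong (_+ f (suc k)) (sumBelow-front k f)) (+-assoc (f 0) _ _)

  sumBelow-split : ∀ k l f → sumBelow (k + l) f ≡ sumBelow k f + sumBelow l (λ i → f (k + i))
  sumBelow-split k zero    f = trans (cong (λ x → sumBelow x f) (+-identityʳ k)) (sym (+-identityʳ _))
  sumBelow-split k (suc l) f = begin
      sumBelow (k + suc l) f                                    ≡⟨ cong (λ x → sumBelow x f) (+-suc k l) ⟩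
      sumBelow (k + l) f + f (k + l)                            ≡⟨ cong (_+ f (k + l)) (sumBelow-split k l f) ⟩
      (sumBelow k f + sumBelow l (λ i → f (k + i))) + f (k + l) ≡⟨ +-assoc (sumBelow k f) _ _ ⟩
      sumBelow k f + (sumBelow l (λ i → f (k + i)) + f (k + l)) ∎
    where open ≡-Reasoning

  sumBelow-truncate : ∀ m d f → (∀ i → m ≤ i → i < m + d → f i ≡ 0) → sumBelow (m + d) f ≡ sumBelow m f
  sumBelow-truncate m d f vanish = begin
      sumBelow (m + d) f                                ≡⟨ sumBelow-split m d f ⟩
      sumBelow m f + sumBelow d (λ i → f (m + i))       ≡⟨ cong (sumBelow m f +_) (sumBelow-zero d tail) ⟩
      sumBelow m f + 0                                  ≡⟨ +-identityʳ _ ⟩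
      sumBelow m f                                      ∎
    where
    open ≡-Reasoning
    tail : ∀ i → i < d → f (m + i) ≡ 0
    tail i i<d = vanish (m + i) (m≤m+n m i) (+-monoʳ-< m i<d)

  indicator-step : ∀ c k h → (if leq c k then h else 0) ≡ (if leq (suc c) k then h else 0) + (if k ≡ᵇ c then h else 0)
  indicator-step zero    zero    h = refl
  indicator-step zero    (suc k) h = sym (+-identityʳ h)
  indicator-step (suc c) zero    h = refl
  indicator-step (suc c) (suc k) h = indicator-step c k h

  sumBelow-indicator : ∀ k c h g → sumBelow k (λ a → (if a ≡ᵇ c then h else 0) + g a)
                                   ≡ (if leq (suc c) k then h else 0) + sumBelow k g
  sumBelow-indicator zero    c h g = refl
  sumBelow-indicator (suc k) c h g = begin
      sumBelow k (λ a → δ a + g a) + (δ k + g k)      ≡⟨ cong (_+ (δ k + g k)) (sumBelow-indicator k c h g) ⟩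
      (hit (suc c) + sumBelow k g) + (δ k + g k)      ≡⟨ interchange (hit (suc c)) (sumBelow k g) (δ k) (g k) ⟩
      (hit (suc c) + δ k) + (sumBelow k g + g k)      ≡⟨ cong (_+ (sumBelow k g + g k)) (sym (indicator-step c k h)) ⟩
      hit c + (sumBelow k g + g k)                    ∎
    where
    open ≡-Reasoning
    δ : ℕ → ℕ
    δ a = if a ≡ᵇ c then h else 0
    hit : ℕ → ℕ
    hit c′ = if leq c′ k then h else 0
    interchange : ∀ a b c d → (a + b) + (c + d) ≡ (a + c) + (b + d)
    interchange = solve-∀

  ∸-<-bound : ∀ t m i → m < i → i ≤ t + m → (t + m) ∸ i < t
  ∸-<-bound t m i m<i i≤ = +-cancelʳ-< i ((t + m) ∸ i) t
    (subst (_< t + i) (sym (m∸n+n≡m i≤)) (+-monoʳ-< t m<i))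

  -- triple n = 3n, by a recursion under which F n (triple n + m) unfolds one part at a time
  triple : ℕ → ℕ
  triple zero    = 0
  triple (suc n) = 3 + triple n

  triple≡3* : ∀ n → triple n ≡ 3 * n
  triple≡3* zero    = refl
  triple≡3* (suc n) = trans (cong (3 +_) (triple≡3* n)) (sym (*-suc 3 n))

  -- F n m y z counts sequences of n parts with sum m, built from the bottom up,
  -- in which every part fits above the two parts below it; y, z are the two
  -- (virtual) parts below the smallest one.
  F : ℕ → ℕ → ℕ → ℕ → ℕ
  F zero    zero    y z = 1
  F zero    (suc m) y z = 0
  F (suc n) m       y z = sumBelow (suc m) (λ a → if fits a y z then F n (m ∸ a) a y else 0)

  -- Every part is at least 3, so n parts cannot sum to less than 3n.
  F-below : ∀ n r y z → r < triple n → F n r y z ≡ 0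
  F-below zero    r y z ()
  F-below (suc n) r y z r<3n+3 = sumBelow-zero (suc r) term
    where
    term : ∀ a → a < suc r → (if fits a y z then F n (r ∸ a) a y else 0) ≡ 0
    term a a<1+r with fits a y z in fit
    ... | false = refl
    ... | true  = F-below n (r ∸ a) a y rest<
      where
      a≤r : a ≤ r
      a≤r = ≤-pred a<1+r
      3+3n≤3n+a : 3 + triple n ≤ triple n + a
      3+3n≤3n+a = subst (3 + triple n ≤_) (+-comm a (triple n)) (+-monoˡ-≤ (triple n) (fits⇒3≤ a y z fit))
      rest< : r ∸ a < triple n
      rest< = +-cancelʳ-< a (r ∸ a) (triple n)
                (subst (_< triple n + a) (sym (m∸n+n≡m a≤r)) (<-≤-trans r<3n+3 3+3n≤3n+a))

  -- Adding 3 to every part (and to the two virtual parts) preserves all conditions: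
  -- F n (3n + m) (y + 3) (z + 3) = F n m y z.
  F-shift : ∀ n m y z → F n (triple n + m) (3 + y) (3 + z) ≡ F n m y z
  F-shift zero    zero    y z = refl
  F-shift zero    (suc m) y z = refl
  F-shift (suc n) m       y z = begin
      F (suc n) (triple (suc n) + m) (3 + y) (3 + z)   ≡⟨ sumBelow-split 3 (suc K) _ ⟩
      sumBelow (suc K) shifted                          ≡⟨ cong (λ x → sumBelow (suc x) shifted) (+-comm (triple n) m) ⟩
      sumBelow (suc m + triple n) shifted               ≡⟨ sumBelow-truncate (suc m) (triple n) shifted tooLarge ⟩
      sumBelow (suc m) shifted                          ≡⟨ sumBelow-cong (suc m) same ⟩
      F (suc n) m y z                                   ∎
    where
    open ≡-Reasoning
    K : ℕ
    K = triple n + m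
    -- the summand for the part 3 + i, whose conditions reduce to those for i
    shifted : ℕ → ℕ
    shifted i = if fits i y z then F n (K ∸ i) (3 + i) (3 + y) else 0
    tooLarge : ∀ i → suc m ≤ i → i < suc m + triple n → shifted i ≡ 0
    tooLarge i m<i i< with fits i y z
    ... | false = refl
    ... | true  = F-below n (K ∸ i) (3 + i) (3 + y)
                    (∸-<-bound (triple n) m i m<i (subst (i ≤_) (+-comm m (triple n)) (≤-pred i<)))
    same : ∀ i → i < suc m → shifted i ≡ (if fits i y z then F n (m ∸ i) i y else 0)
    same i i≤m with fits i y z
    ... | false = refl
    ... | true  = trans (cong (λ x → F n x (3 + i) (3 + y)) (+-∸-assoc (triple n) (≤-pred i≤m))) (F-shift n (m ∸ i) i y)

module ListCounting where
  open Counting using (sumBelow; sumBelow-front; true≢false)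
  open import Defs using (lists)
  open import Data.Nat using (ℕ; zero; suc; _+_)
  open import Data.Nat.Properties using (+-assoc)
  open import Data.Nat.Tactic.RingSolver using (solve-∀)
  open import Data.Bool using (Bool; true; false; _∧_; if_then_else_)
  open import Data.List using (List; []; _∷_; _++_; map; concatMap; upTo; applyUpTo; _∷ʳ_; length; filter)
  open import Data.Empty using (⊥-elim)
  open import Relation.Nullary using (yes; no)
  open import Relation.Unary using (Decidable)
  open import Relation.Binary.PropositionalEquality

  private variable A B : Set

  countᵇ : (A → Bool) → List A → ℕ
  countᵇ q []       = 0
  countᵇ q (x ∷ xs) = (if q x then 1 else 0) + countᵇ q xs

  countᵇ-++ : ∀ (q : A → Bool) xs ys → countᵇ q (xs ++ ys) ≡ countᵇ q xs + countᵇ q ys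
  countᵇ-++ q []       ys = refl
  countᵇ-++ q (x ∷ xs) ys = trans (cong (_ +_) (countᵇ-++ q xs ys)) (sym (+-assoc (if q x then 1 else 0) _ _))

  countᵇ-map : ∀ (q : B → Bool) (f : A → B) xs → countᵇ q (map f xs) ≡ countᵇ (λ x → q (f x)) xs
  countᵇ-map q f []       = refl
  countᵇ-map q f (x ∷ xs) = cong (_ +_) (countᵇ-map q f xs)

  countᵇ-cong : ∀ {q q′ : A → Bool} xs → (∀ x → q x ≡ q′ x) → countᵇ q xs ≡ countᵇ q′ xs
  countᵇ-cong []       eq = refl
  countᵇ-cong (x ∷ xs) eq = cong₂ _+_ (cong (λ b → if b then 1 else 0) (eq x)) (countᵇ-cong xs eq)

  countᵇ-guard : ∀ b (q : A → Bool) xs → countᵇ (λ x → b ∧ q x) xs ≡ (if b then countᵇ q xs else 0)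
  countᵇ-guard true  q xs       = refl
  countᵇ-guard false q []       = refl
  countᵇ-guard false q (x ∷ xs) = countᵇ-guard false q xs

  length-filter : ∀ {P : A → Set} (P? : Decidable P) (q : A → Bool) xs →
                  (∀ x → P x → q x ≡ true) → (∀ x → q x ≡ true → P x) → length (filter P? xs) ≡ countᵇ q xs
  length-filter P? q []       sound complete = refl
  length-filter P? q (x ∷ xs) sound complete with P? x | q x in qx
  ... | yes _  | true  = cong suc (length-filter P? q xs sound complete)
  ... | yes px | false = ⊥-elim (true≢false (trans (sym (sound x px)) qx))
  ... | no ¬px | true  = ⊥-elim (¬px (complete x qx))
  ... | no _   | false = length-filter P? q xs sound complete

  sumOver : List A → (A → ℕ) → ℕ
  sumOver []       h = 0
  sumOver (a ∷ as) h = h a + sumOver as h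

  sumOver-cong : ∀ (as : List A) {h h′} → (∀ a → h a ≡ h′ a) → sumOver as h ≡ sumOver as h′
  sumOver-cong []       eq = refl
  sumOver-cong (a ∷ as) eq = cong₂ _+_ (eq a) (sumOver-cong as eq)

  sumOver-+ : ∀ (as : List A) f g → sumOver as (λ a → f a + g a) ≡ sumOver as f + sumOver as g
  sumOver-+ []       f g = refl
  sumOver-+ (a ∷ as) f g = trans (cong (f a + g a +_) (sumOver-+ as f g)) (interchange (f a) (g a) (sumOver as f) (sumOver as g))
    where
    interchange : ∀ a b c d → (a + b) + (c + d) ≡ (a + c) + (b + d)
    interchange = solve-∀

  sumOver-0 : ∀ (as : List A) → sumOver as (λ _ → 0) ≡ 0
  sumOver-0 []       = refl
  sumOver-0 (a ∷ as) = sumOver-0 as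

  sumOver-swap : ∀ (as : List A) (bs : List B) (h : A → B → ℕ) →
                 sumOver as (λ a → sumOver bs (h a)) ≡ sumOver bs (λ b → sumOver as (λ a → h a b))
  sumOver-swap []       bs h = sym (sumOver-0 bs)
  sumOver-swap (a ∷ as) bs h =
    trans (cong (sumOver bs (h a) +_) (sumOver-swap as bs h)) (sym (sumOver-+ bs (h a) (λ b → sumOver as (λ a′ → h a′ b))))

  sumOver-map : ∀ (as : List A) (f : A → B) h → sumOver (map f as) h ≡ sumOver as (λ a → h (f a))
  sumOver-map []       f h = refl
  sumOver-map (a ∷ as) f h = cong (h (f a) +_) (sumOver-map as f h)

  sumOver-applyUpTo : ∀ n (f : ℕ → A) h → sumOver (applyUpTo f n) h ≡ sumBelow n (λ i → h (f i))
  sumOver-applyUpTo zero    f h = refl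
  sumOver-applyUpTo (suc n) f h =
    trans (cong (h (f 0) +_) (sumOver-applyUpTo n (λ i → f (suc i)) h)) (sym (sumBelow-front n (λ i → h (f i))))

  countᵇ-concatMap : ∀ (q : B → Bool) (f : A → List B) as →
                     countᵇ q (concatMap f as) ≡ sumOver as (λ a → countᵇ q (f a))
  countᵇ-concatMap q f []       = refl
  countᵇ-concatMap q f (a ∷ as) =
    trans (countᵇ-++ q (f a) (concatMap f as)) (cong (countᵇ q (f a) +_) (countᵇ-concatMap q f as))

  sizes : ℕ → List ℕ
  sizes M = map suc (upTo M)

  sumOver-sizes : ∀ M h → sumOver (sizes M) h ≡ sumBelow M (λ i → h (suc i))
  sumOver-sizes M h = trans (sumOver-map (upTo M) suc h) (sumOver-applyUpTo M (λ i → i) (λ a → h (suc a)))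

  count-by-head : ∀ n M q →
                  countᵇ q (lists (suc n) M) ≡ sumOver (sizes M) (λ a → countᵇ (λ l → q (a ∷ l)) (lists n M))
  count-by-head n M q =
    trans (countᵇ-concatMap q (λ a → map (a ∷_) (lists n M)) (sizes M))
          (sumOver-cong (sizes M) (λ a → countᵇ-map q (a ∷_) (lists n M)))

  count-by-last : ∀ n M q →
                  countᵇ q (lists (suc n) M) ≡ sumOver (sizes M) (λ a → countᵇ (λ l → q (l ∷ʳ a)) (lists n M))
  count-by-last zero    M q = count-by-head zero M q
  count-by-last (suc n) M q = begin
      countᵇ q (lists (suc (suc n)) M)
        ≡⟨ count-by-head (suc n) M q ⟩
      sumOver (sizes M) (λ b → countᵇ (λ l → q (b ∷ l)) (lists (suc n) M))
        ≡⟨ sumOver-cong (sizes M) (λ b → count-by-last n M (λ l → q (b ∷ l))) ⟩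
      sumOver (sizes M) (λ b → sumOver (sizes M) (λ a → countᵇ (λ l → q (b ∷ (l ∷ʳ a))) (lists n M)))
        ≡⟨ sumOver-swap (sizes M) (sizes M) _ ⟩
      sumOver (sizes M) (λ a → sumOver (sizes M) (λ b → countᵇ (λ l → q (b ∷ (l ∷ʳ a))) (lists n M)))
        ≡⟨ sumOver-cong (sizes M) (λ a → sym (count-by-head n M (λ l → q (l ∷ʳ a)))) ⟩
      sumOver (sizes M) (λ a → countᵇ (λ l → q (l ∷ʳ a)) (lists (suc n) M)) ∎
    where open ≡-Reasoning

module Enumeration where
  open Counting
  open ListCounting
  open import Defs using (Admissible; AdjCond; Gap2Cond; ones; lists; g; admissible?)
  open import Data.Nat using (ℕ; zero; suc; _+_; _∸_; _≤_; _<_; _≡ᵇ_; _%_; z≤n; s≤s)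
  open import Data.Nat.Properties
    using (≤-refl; ≤-trans; <-irrefl; n≤1+n; m≤m+n; m∸n≤m; +-comm; +-identityʳ; +-suc; m+[n∸m]≡n; +-∸-assoc;
           ≡⇒≡ᵇ)
  open import Data.Nat.DivMod using (%-distribˡ-+)
  open import Data.Nat.ListAction using (sum)
  open import Data.Nat.ListAction.Properties using (sum-++)
  open import Data.Bool using (Bool; true; false; _∧_; if_then_else_)
  open import Data.Bool.Properties using (∧-identityʳ; ∧-assoc; ∧-zeroʳ; T-≡)
  open import Data.List using (List; []; _∷_; map; _∷ʳ_)
  open import Data.List.Properties using (map-++)
  open import Data.List.Relation.Unary.All using (All; []; _∷_)
  open import Data.Product using (_×_; _,_; proj₁; proj₂)
  open import Data.Unit using (tt)
  open import Data.Empty using (⊥-elim)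
  open import Function.Bundles using (Equivalence)
  open import Relation.Binary.PropositionalEquality

  below₁ : List ℕ → ℕ → ℕ
  below₁ []      y = y
  below₁ (c ∷ _) y = c

  below₂ : List ℕ → ℕ → ℕ → ℕ
  below₂ []          y z = z
  below₂ (_ ∷ [])    y z = y
  below₂ (_ ∷ d ∷ _) y z = d

  validChain : List ℕ → ℕ → ℕ → Bool
  validChain []      y z = true
  validChain (b ∷ l) y z = fits b (below₁ l y) (below₂ l y z) ∧ validChain l y z

  below₁-∷ʳ : ∀ l a y → below₁ (l ∷ʳ a) y ≡ below₁ l a
  below₁-∷ʳ []      a y = refl
  below₁-∷ʳ (c ∷ l) a y = refl

  below₂-∷ʳ : ∀ l a y z → below₂ (l ∷ʳ a) y z ≡ below₂ l a y
  below₂-∷ʳ []          a y z = refl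
  below₂-∷ʳ (c ∷ [])    a y z = refl
  below₂-∷ʳ (c ∷ d ∷ l) a y z = refl

  validChain-∷ʳ : ∀ l a y z → validChain (l ∷ʳ a) y z ≡ validChain l a y ∧ fits a y z
  validChain-∷ʳ []      a y z = ∧-identityʳ (fits a y z)
  validChain-∷ʳ (b ∷ l) a y z rewrite below₁-∷ʳ l a y | below₂-∷ʳ l a y z | validChain-∷ʳ l a y z =
    sym (∧-assoc (fits b (below₁ l a) (below₂ l a y)) (validChain l a y) (fits a y z))

  +-≡ᵇ-∸ : ∀ s a m → (s + a ≡ᵇ m) ≡ leq a m ∧ (s ≡ᵇ m ∸ a)
  +-≡ᵇ-∸ s zero    m       rewrite +-identityʳ s = refl
  +-≡ᵇ-∸ s (suc a) zero    rewrite +-suc s a = refl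
  +-≡ᵇ-∸ s (suc a) (suc m) rewrite +-suc s a = +-≡ᵇ-∸ s a m

  accepts : ℕ → ℕ → ℕ → List ℕ → Bool
  accepts m y z l = validChain (map (3 +_) l) y z ∧ (sum l ≡ᵇ m)

  accepts-∷ʳ : ∀ m y z l a → accepts m y z (l ∷ʳ a) ≡ (leq a m ∧ fits (3 + a) y z) ∧ accepts (m ∸ a) (3 + a) y l
  accepts-∷ʳ m y z l a
    rewrite map-++ (3 +_) l (a ∷ []) | validChain-∷ʳ (map (3 +_) l) (3 + a) y z
          | sum-++ l (a ∷ []) | +-identityʳ a | +-≡ᵇ-∸ (sum l) a m
    = regroup (validChain (map (3 +_) l) (3 + a) y) (fits (3 + a) y z) (leq a m) (sum l ≡ᵇ m ∸ a)
    where
    regroup : ∀ v f l s → (v ∧ f) ∧ (l ∧ s) ≡ (l ∧ f) ∧ (v ∧ s)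
    regroup true  f true  s = refl
    regroup true  f false s = ∧-zeroʳ f
    regroup false f true  s = sym (∧-zeroʳ f)
    regroup false f false s = refl

  acceptedCount : ℕ → ℕ → ℕ → ℕ → ℕ → ℕ
  acceptedCount n M m y z = countᵇ (accepts m y z) (lists n M)

  acceptedCount-by-last : ∀ n M m y z → acceptedCount (suc n) M m y z
    ≡ sumBelow M (λ i → if leq (suc i) m ∧ fits (4 + i) y z then acceptedCount n M (m ∸ suc i) (4 + i) y else 0)
  acceptedCount-by-last n M m y z = begin
      acceptedCount (suc n) M m y z
        ≡⟨ count-by-last n M (accepts m y z) ⟩
      sumOver (sizes M) (λ a → countᵇ (λ l → accepts m y z (l ∷ʳ a)) (lists n M))
        ≡⟨ sumOver-cong (sizes M) peel ⟩
      sumOver (sizes M) (λ a → if leq a m ∧ fits (3 + a) y z then acceptedCount n M (m ∸ a) (3 + a) y else 0)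
        ≡⟨ sumOver-sizes M _ ⟩
      sumBelow M (λ i → if leq (suc i) m ∧ fits (4 + i) y z then acceptedCount n M (m ∸ suc i) (4 + i) y else 0) ∎
    where
    open ≡-Reasoning
    peel : ∀ a → countᵇ (λ l → accepts m y z (l ∷ʳ a)) (lists n M)
                 ≡ (if leq a m ∧ fits (3 + a) y z then acceptedCount n M (m ∸ a) (3 + a) y else 0)
    peel a = trans (countᵇ-cong (lists n M) (λ l → accepts-∷ʳ m y z l a))
                   (countᵇ-guard (leq a m ∧ fits (3 + a) y z) _ (lists n M))

  -- When z ≥ 1 every part is at least 4; F then decomposes by its smallest part 4 + i, i < m.
  F-by-smallest : ∀ n m y z → F (suc n) (triple (suc n) + m) y (suc z)
    ≡ sumBelow m (λ i → if fits (4 + i) y (suc z) then F n (triple n + (m ∸ suc i)) (4 + i) y else 0)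
  F-by-smallest n m y z = begin
      F (suc n) (triple (suc n) + m) y (suc z) ≡⟨ sumBelow-split 4 K _ ⟩
      sumBelow K smallest                      ≡⟨ cong (λ x → sumBelow x smallest) (+-comm (triple n) m) ⟩
      sumBelow (m + triple n) smallest         ≡⟨ sumBelow-truncate m (triple n) smallest tooLarge ⟩
      sumBelow m smallest                      ≡⟨ sumBelow-cong m rest ⟩
      sumBelow m (λ i → if fits (4 + i) y (suc z) then F n (triple n + (m ∸ suc i)) (4 + i) y else 0) ∎
    where
    open ≡-Reasoning
    K : ℕ
    K = triple n + m
    smallest : ℕ → ℕ
    smallest i = if fits (4 + i) y (suc z) then F n (K ∸ suc i) (4 + i) y else 0
    tooLarge : ∀ i → m ≤ i → i < m + triple n → smallest i ≡ 0
    tooLarge i m≤i i< with fits (4 + i) y (suc z)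
    ... | false = refl
    ... | true  = F-below n (K ∸ suc i) (4 + i) y
                    (∸-<-bound (triple n) m (suc i) (s≤s m≤i) (subst (suc i ≤_) (+-comm m (triple n)) i<))
    rest : ∀ i → i < m → smallest i ≡ (if fits (4 + i) y (suc z) then F n (triple n + (m ∸ suc i)) (4 + i) y else 0)
    rest i i<m with fits (4 + i) y (suc z)
    ... | false = refl
    ... | true  = cong (λ x → F n x (4 + i) y) (+-∸-assoc (triple n) i<m)

  acceptedCount≡F : ∀ n M m y z → m ≤ M → acceptedCount n M m (suc y) (suc z) ≡ F n (triple n + m) (suc y) (suc z)
  acceptedCount≡F zero    M zero    y z _   = refl
  acceptedCount≡F zero    M (suc m) y z _   = refl
  acceptedCount≡F (suc n) M m       y z m≤M = begin
      acceptedCount (suc n) M m (suc y) (suc z) ≡⟨ acceptedCount-by-last n M m (suc y) (suc z) ⟩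
      sumBelow M byLast                         ≡⟨ sumBelow-cong M (λ i _ → induction i) ⟩
      sumBelow M byLastF                        ≡⟨ cong (λ x → sumBelow x byLastF) (sym (m+[n∸m]≡n m≤M)) ⟩
      sumBelow (m + (M ∸ m)) byLastF            ≡⟨ sumBelow-truncate m (M ∸ m) byLastF (λ i m≤i _ → tooLarge i m≤i) ⟩
      sumBelow m byLastF                        ≡⟨ sumBelow-cong m small ⟩
      sumBelow m (λ i → if fits (4 + i) (suc y) (suc z) then F n (triple n + (m ∸ suc i)) (4 + i) (suc y) else 0)
                                                ≡⟨ sym (F-by-smallest n m (suc y) z) ⟩
      F (suc n) (triple (suc n) + m) (suc y) (suc z) ∎
    where
    open ≡-Reasoning
    byLast : ℕ → ℕ
    byLast i = if leq (suc i) m ∧ fits (4 + i) (suc y) (suc z) then acceptedCount n M (m ∸ suc i) (4 + i) (suc y) else 0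
    byLastF : ℕ → ℕ
    byLastF i = if leq (suc i) m ∧ fits (4 + i) (suc y) (suc z) then F n (triple n + (m ∸ suc i)) (4 + i) (suc y) else 0
    induction : ∀ i → byLast i ≡ byLastF i
    induction i with leq (suc i) m ∧ fits (4 + i) (suc y) (suc z)
    ... | false = refl
    ... | true  = acceptedCount≡F n M (m ∸ suc i) (3 + i) y (≤-trans (m∸n≤m m (suc i)) m≤M)
    tooLarge : ∀ i → m ≤ i → byLastF i ≡ 0
    tooLarge i m≤i rewrite >⇒leq-false {suc i} {m} (s≤s m≤i) = refl
    small : ∀ i → i < m → byLastF i ≡ (if fits (4 + i) (suc y) (suc z) then F n (triple n + (m ∸ suc i)) (4 + i) (suc y) else 0)
    small i i<m rewrite ≤⇒leq i<m = refl

  Adjacent : ℕ → ℕ → Set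
  Adjacent a b = a ≤ b + 1 → (a + b) % 3 ≡ 2

  -- adjacentOK decides Adjacent, since (a + b) % 3 = (a % 3 + b % 3) % 3
  adjacentOK⇒Adjacent : ∀ a b → adjacentOK a b ≡ true → Adjacent a b
  adjacentOK⇒Adjacent a b ok a≤b+1 with leq a (suc b) in close
  ... | true  = trans (%-distribˡ-+ a b 3) (≡ᵇ-true⇒≡ ok)
  ... | false = ⊥-elim (true≢false (trans (sym (≤⇒leq (subst (a ≤_) (+-comm b 1) a≤b+1))) close))

  Adjacent⇒adjacentOK : ∀ a b → Adjacent a b → adjacentOK a b ≡ true
  Adjacent⇒adjacentOK a b adj with leq a (suc b) in close
  ... | true  = Equivalence.to T-≡ (≡⇒≡ᵇ _ 2 (trans (sym (%-distribˡ-+ a b 3)) (adj a≤b+1)))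
    where
    a≤b+1 : a ≤ b + 1
    a≤b+1 = subst (a ≤_) (+-comm 1 b) (leq⇒≤ a (suc b) close)
  ... | false = refl

  -- the single-part list [a] is always adjacent-compatible with the virtual part 2 (i.e. -1)
  adjacentOK-bottom : ∀ a → adjacentOK (3 + a) 2 ≡ true
  adjacentOK-bottom zero    = refl
  adjacentOK-bottom (suc a) = refl

  Above : ℕ → ℕ → Set
  Above a b = b ≤ a × Adjacent a b

  above⇒ : ∀ a b → (leq b a ∧ adjacentOK a b) ≡ true → Above a b
  above⇒ a b p with ∧-split (leq b a) p
  ... | b≤a , adj = leq⇒≤ b a b≤a , adjacentOK⇒Adjacent a b adj

  ⇒above : ∀ a b → Above a b → (leq b a ∧ adjacentOK a b) ≡ true
  ⇒above a b (b≤a , adj) = ∧-join (≤⇒leq b≤a) (Adjacent⇒adjacentOK a b adj)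

  ones-[_] : ∀ a → ones (a ∷ []) ≤ 1
  ones-[ a ] with a ≡ᵇ 1
  ... | true  = s≤s z≤n
  ... | false = z≤n

  ones-∷ : ∀ a l → ones l ≤ ones (a ∷ l)
  ones-∷ a l with a ≡ᵇ 1
  ... | true  = n≤1+n _
  ... | false = ≤-refl

  ones-∷-≥2 : ∀ a l → 2 ≤ a → ones (a ∷ l) ≡ ones l
  ones-∷-≥2 a l 2≤a with a ≡ᵇ 1 in a≡1
  ... | false = refl
  ... | true with ≡ᵇ-true⇒≡ {a} {1} a≡1
  ...   | refl = ⊥-elim (<-irrefl refl 2≤a)

  top-of-two≥2 : ∀ a b → 1 ≤ b → b ≤ a → ones (a ∷ b ∷ []) ≤ 1 → 2 ≤ a
  top-of-two≥2 (suc zero)    (suc zero)    _ _         (s≤s ())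
  top-of-two≥2 (suc zero)    (suc (suc b)) _ (s≤s ())  _
  top-of-two≥2 (suc (suc a)) b             _ _         _ = s≤s (s≤s z≤n)

  Good : List ℕ → Set
  Good l = All (1 ≤_) l × (AdjCond l × (Gap2Cond l × ones l ≤ 1))

  -- With the virtual parts 2, 1 (standing for -1, -2) below, the shifted list is a valid chain
  -- exactly when the list is good: the gap to the part -2 forces parts ≥ 1, and the gap between
  -- a second-smallest part a and the part -1 forces a ≥ 2, i.e. the part 1 occurs at most once.
  good⇒validChain : ∀ l → Good l → validChain (map (3 +_) l) 2 1 ≡ true
  good⇒validChain []                 _ = refl
  good⇒validChain (a ∷ [])           (1≤a ∷ [] , _) =
    ∧-join (∧-join (≤⇒leq 1≤a) (adjacentOK-bottom a)) refl
  good⇒validChain (a ∷ b ∷ [])       (1≤a ∷ 1≤b ∷ [] , (b≤a , adj , _) , _ , o) =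
    ∧-join (∧-join (≤⇒leq (top-of-two≥2 a b 1≤b b≤a o)) (⇒above a b (b≤a , adj)))
           (good⇒validChain (b ∷ []) (1≤b ∷ [] , tt , tt , ones-[ b ]))
  good⇒validChain (a ∷ b ∷ c ∷ l)    (1≤a ∷ all , (b≤a , adj , adjs) , (gap , gaps) , o) =
    ∧-join (∧-join (≤⇒leq (subst (_≤ a) (+-comm c 3) gap)) (⇒above a b (b≤a , adj)))
           (good⇒validChain (b ∷ c ∷ l) (all , adjs , gaps , ≤-trans (ones-∷ a (b ∷ c ∷ l)) o))

  good-∷₂ : ∀ a b → (leq 2 a ∧ (leq b a ∧ adjacentOK a b)) ≡ true → Good (b ∷ []) → Good (a ∷ b ∷ [])
  good-∷₂ a b head (all , _ , _ , o) =
    (≤-trans (s≤s z≤n) 2≤a ∷ all) , (b≤a , adj , tt) , tt , subst (_≤ 1) (sym (ones-∷-≥2 a (b ∷ []) 2≤a)) o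
    where
    parts : (leq 2 a ≡ true) × ((leq b a ∧ adjacentOK a b) ≡ true)
    parts = ∧-split (leq 2 a) head
    2≤a : 2 ≤ a
    2≤a = leq⇒≤ 2 a (proj₁ parts)
    b≤a : b ≤ a
    b≤a = proj₁ (above⇒ a b (proj₂ parts))
    adj : Adjacent a b
    adj = proj₂ (above⇒ a b (proj₂ parts))

  good-∷₃ : ∀ a b c l → (leq (3 + c) a ∧ (leq b a ∧ adjacentOK a b)) ≡ true →
            Good (b ∷ c ∷ l) → Good (a ∷ b ∷ c ∷ l)
  good-∷₃ a b c l head (all , adjs , gaps , o) =
    (≤-trans (s≤s z≤n) 3≤a ∷ all) , (b≤a , adj , adjs) , (subst (_≤ a) (+-comm 3 c) 3+c≤a , gaps) ,
    subst (_≤ 1) (sym (ones-∷-≥2 a (b ∷ c ∷ l) (≤-trans (s≤s (s≤s z≤n)) 3≤a))) o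
    where
    parts : (leq (3 + c) a ≡ true) × ((leq b a ∧ adjacentOK a b) ≡ true)
    parts = ∧-split (leq (3 + c) a) head
    3+c≤a : 3 + c ≤ a
    3+c≤a = leq⇒≤ (3 + c) a (proj₁ parts)
    3≤a : 3 ≤ a
    3≤a = ≤-trans (m≤m+n 3 c) 3+c≤a
    b≤a : b ≤ a
    b≤a = proj₁ (above⇒ a b (proj₂ parts))
    adj : Adjacent a b
    adj = proj₂ (above⇒ a b (proj₂ parts))

  validChain⇒good : ∀ l → validChain (map (3 +_) l) 2 1 ≡ true → Good l
  validChain⇒good []              _ = [] , tt , tt , z≤n
  validChain⇒good (a ∷ [])        p =
    let (head , _) = ∧-split (leq 1 a ∧ adjacentOK (3 + a) 2) p
        (1≤a , _)  = ∧-split (leq 1 a) head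
    in (leq⇒≤ 1 a 1≤a ∷ []) , tt , tt , ones-[ a ]
  validChain⇒good (a ∷ b ∷ [])    p =
    let (head , rest) = ∧-split (leq 2 a ∧ (leq b a ∧ adjacentOK a b)) p
    in good-∷₂ a b head (validChain⇒good (b ∷ []) rest)
  validChain⇒good (a ∷ b ∷ c ∷ l) p =
    let (head , rest) = ∧-split (leq (3 + c) a ∧ (leq b a ∧ adjacentOK a b)) p
    in good-∷₃ a b c l head (validChain⇒good (b ∷ c ∷ l) rest)

  admissible⇒accepts : ∀ m l → Admissible m l → accepts m 2 1 l ≡ true
  admissible⇒accepts m l (all , sum≡m , adjs , gaps , o) =
    ∧-join (good⇒validChain l (all , adjs , gaps , o)) (Equivalence.to T-≡ (≡⇒≡ᵇ (sum l) m sum≡m))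

  accepts⇒admissible : ∀ m l → accepts m 2 1 l ≡ true → Admissible m l
  accepts⇒admissible m l p with ∧-split (validChain (map (3 +_) l) 2 1) p
  ... | valid , sum≡m with validChain⇒good l valid
  ...   | all , adjs , gaps , o = all , ≡ᵇ-true⇒≡ sum≡m , adjs , gaps , o

  g≡F : ∀ n m → g n m ≡ F n (triple n + m) 2 1
  g≡F n m = trans (length-filter (admissible? m) (accepts m 2 1) (lists n m) (admissible⇒accepts m) (accepts⇒admissible m))
                  (acceptedCount≡F n m m 1 0 ≤-refl)

module Relations where
  open Counting
  open import Data.Nat using (ℕ; zero; suc; _+_; _*_; _∸_; _≤_; _<_; _<ᵇ_; _≡ᵇ_; s≤s)
  open import Data.Nat.Properties
    using (≤-trans; ≤-pred; m≤n+m; m≤m+n; +-monoʳ-≤; n≤1+n; ≤-<-connex; ≤-antisym; <⇒≱; <ᵇ⇒<;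
           +-identityʳ; +-assoc; *-identityˡ)
  open import Data.Bool using (Bool; true; false; _∧_; _∨_; if_then_else_)
  open import Data.Bool.Properties using (∧-zeroʳ; T-≡)
  open import Data.List using (List; []; _∷_; foldr)
  open import Data.Product using (_×_; _,_)
  open import Data.Sum using (inj₁; inj₂)
  open import Data.Empty using (⊥-elim)
  open import Function.Bundles using (Equivalence)
  open import Relation.Binary.PropositionalEquality

  -- Parts above the bottom part a are ≥ a.
  F-bottom-irrelevant : ∀ n m a y y′ → 3 + y ≤ a → 3 + y′ ≤ a → F n m a y ≡ F n m a y′
  F-bottom-irrelevant zero    zero    a y y′ _ _ = refl
  F-bottom-irrelevant zero    (suc m) a y y′ _ _ = refl
  F-bottom-irrelevant (suc n) m       a y y′ y+3≤a y′+3≤a = sumBelow-cong (suc m) same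
    where
    same : ∀ b → b < suc m → (if fits b a y then F n (m ∸ b) b a else 0) ≡ (if fits b a y′ then F n (m ∸ b) b a else 0)
    same b _ with leq a b in a≤b
    ... | false rewrite ∧-zeroʳ (leq (3 + y) b) | ∧-zeroʳ (leq (3 + y′) b) = refl
    ... | true  rewrite ≤⇒leq (≤-trans y+3≤a (leq⇒≤ a b a≤b)) | ≤⇒leq (≤-trans y′+3≤a (leq⇒≤ a b a≤b)) = refl

  fits-large : ∀ a y z → 3 + y ≤ a → 3 + z ≤ a → fits a y z ≡ true
  fits-large a y z y+3≤a z+3≤a
    rewrite ≤⇒leq z+3≤a | ≤⇒leq (≤-trans (m≤n+m y 3) y+3≤a)
          | >⇒leq-false {a} {suc y} (≤-trans (s≤s (s≤s (n≤1+n y))) y+3≤a)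
    = refl

  multiplicity : ℕ → List ℕ → ℕ
  multiplicity a []      = 0
  multiplicity a (c ∷ L) = (if a ≡ᵇ c then 1 else 0) + multiplicity a L

  entriesBelow : ℕ → List ℕ → Bool
  entriesBelow B []      = true
  entriesBelow B (c ∷ L) = (c <ᵇ B) ∧ entriesBelow B L

  multiplicity-large : ∀ B L a → entriesBelow B L ≡ true → B ≤ a → multiplicity a L ≡ 0
  multiplicity-large B []      a _ _ = refl
  multiplicity-large B (c ∷ L) a p B≤a with ∧-split (c <ᵇ B) p
  ... | c<B , rest with a ≡ᵇ c in a≡c
  ...   | false = multiplicity-large B L a rest B≤a
  ...   | true = ⊥-elim (<⇒≱ (<ᵇ⇒< c B (Equivalence.from T-≡ c<B)) (subst (B ≤_) (≡ᵇ-true⇒≡ a≡c) B≤a))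

  sameAbove : ℕ → ℕ → ℕ → Bool
  sameAbove y y′ a = (leq (3 + y) a ∧ leq (3 + y′) a) ∨ (y ≡ᵇ y′)

  sameAbove⇒≡ : ∀ n k a y y′ → sameAbove y y′ a ≡ true → F n k a y ≡ F n k a y′
  sameAbove⇒≡ n k a y y′ p with leq (3 + y) a ∧ leq (3 + y′) a in far
  ... | true  = let (y+3≤a , y′+3≤a) = ∧-split (leq (3 + y) a) far
                in F-bottom-irrelevant n k a y y′ (leq⇒≤ (3 + y) a y+3≤a) (leq⇒≤ (3 + y′) a y′+3≤a)
  ... | false rewrite ≡ᵇ-true⇒≡ {y} {y′} p = refl

  -- Comparison of the bottom terms of F for (y, z) and (y′, z′) at a bottom part a that
  -- occurs k times in L: a fits both (and the parts above do not see the change), or it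
  -- fits (y, z) only and k = 1, or it fits neither and k = 0.
  comparable : Bool → Bool → ℕ → Bool → Bool
  comparable fits₁ fits₂ k same =
    if fits₁ then (if fits₂ then (k ≡ᵇ 0) ∧ same else k ≡ᵇ 1) else (if fits₂ then false else k ≡ᵇ 0)

  spikeOK : ℕ → ℕ → List ℕ → ℕ → ℕ → ℕ → Bool
  spikeOK y z L y′ z′ a = comparable (fits a y z) (fits a y′ z′) (multiplicity a L) (sameAbove y y′ a)

  spikeOK⇒ : ∀ n m y z L y′ z′ a → spikeOK y z L y′ z′ a ≡ true →
             (if fits a y z then F n (m ∸ a) a y else 0)
             ≡ multiplicity a L * F n (m ∸ a) a y + (if fits a y′ z′ then F n (m ∸ a) a y′ else 0)
  spikeOK⇒ n m y z L y′ z′ a ok with fits a y z | fits a y′ z′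
  ... | true  | true  =
    let (k≡0 , same) = ∧-split (multiplicity a L ≡ᵇ 0) ok
    in trans (sameAbove⇒≡ n (m ∸ a) a y y′ same)
             (cong (λ k → k * F n (m ∸ a) a y + F n (m ∸ a) a y′) (sym (≡ᵇ-true⇒≡ {multiplicity a L} {0} k≡0)))
  ... | true  | false rewrite ≡ᵇ-true⇒≡ {multiplicity a L} {1} ok =
    sym (trans (+-identityʳ _) (*-identityˡ _))
  ... | false | false rewrite ≡ᵇ-true⇒≡ {multiplicity a L} {0} ok = refl

  allBelow : ℕ → (ℕ → Bool) → Bool
  allBelow zero    p = true
  allBelow (suc B) p = allBelow B p ∧ p B

  allBelow⇒ : ∀ B p a → allBelow B p ≡ true → a < B → p a ≡ true
  allBelow⇒ (suc B) p a all a<1+B with ∧-split (allBelow B p) all | ≤-<-connex B a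
  ... | _     , pB | inj₁ B≤a rewrite ≤-antisym (≤-pred a<1+B) B≤a = pB
  ... | below , _  | inj₂ a<B = allBelow⇒ B p a below a<B

  -- Above B = 3 + y + z + y′ + z′ every part fits both (y, z) and (y′, z′) and no entry of L
  -- occurs, so the comparison only needs to be evaluated below B.
  spikeBound : ℕ → ℕ → ℕ → ℕ → ℕ
  spikeBound y z y′ z′ = 3 + (y + z + y′ + z′)

  spikeCheck : ℕ → ℕ → List ℕ → ℕ → ℕ → Bool
  spikeCheck y z L y′ z′ = entriesBelow B L ∧ allBelow B (spikeOK y z L y′ z′)
    where
    B : ℕ
    B = spikeBound y z y′ z′

  beyond-bound : ∀ y z y′ z′ a → spikeBound y z y′ z′ ≤ a →
                 (3 + y ≤ a) × (3 + z ≤ a) × (3 + y′ ≤ a) × (3 + z′ ≤ a)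
  beyond-bound y z y′ z′ a B≤a =
    far (≤-trans (≤-trans (m≤m+n y z) (m≤m+n (y + z) y′)) (m≤m+n (y + z + y′) z′)) ,
    far (≤-trans (≤-trans (m≤n+m z y) (m≤m+n (y + z) y′)) (m≤m+n (y + z + y′) z′)) ,
    far (≤-trans (m≤n+m y′ (y + z)) (m≤m+n (y + z + y′) z′)) ,
    far (m≤n+m z′ (y + z + y′))
    where
    far : ∀ {u} → u ≤ y + z + y′ + z′ → 3 + u ≤ a
    far u≤S = ≤-trans (+-monoʳ-≤ 3 u≤S) B≤a

  spikeOK-large : ∀ y z L y′ z′ a B → (3 + y ≤ a) × (3 + z ≤ a) × (3 + y′ ≤ a) × (3 + z′ ≤ a) →
                  entriesBelow B L ≡ true → B ≤ a → spikeOK y z L y′ z′ a ≡ true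
  spikeOK-large y z L y′ z′ a B (y≪a , z≪a , y′≪a , z′≪a) entries B≤a
    rewrite fits-large a y z y≪a z≪a | fits-large a y′ z′ y′≪a z′≪a | multiplicity-large B L a entries B≤a
          | ≤⇒leq y≪a | ≤⇒leq y′≪a = refl

  spikeCheck⇒spikeOK : ∀ y z L y′ z′ → spikeCheck y z L y′ z′ ≡ true → ∀ a → spikeOK y z L y′ z′ a ≡ true
  spikeCheck⇒spikeOK y z L y′ z′ check a with ∧-split (entriesBelow (spikeBound y z y′ z′) L) check
  ... | entries , below with ≤-<-connex (spikeBound y z y′ z′) a
  ...   | inj₁ B≤a = spikeOK-large y z L y′ z′ a _ (beyond-bound y z y′ z′ a B≤a) entries B≤a
  ...   | inj₂ a<B = allBelow⇒ (spikeBound y z y′ z′) (spikeOK y z L y′ z′) a below a<B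

  spikesAt : List ℕ → ℕ → ℕ → ℕ → ℕ → ℕ → ℕ
  spikesAt L n m y a R = foldr (λ c acc → (if a ≡ᵇ c then F n (m ∸ c) c y else 0) + acc) R L

  spikesAt-multiplicity : ∀ L n m y a R → spikesAt L n m y a R ≡ multiplicity a L * F n (m ∸ a) a y + R
  spikesAt-multiplicity []      n m y a R = refl
  spikesAt-multiplicity (c ∷ L) n m y a R with a ≡ᵇ c in a≡c
  ... | false = spikesAt-multiplicity L n m y a R
  ... | true rewrite ≡ᵇ-true⇒≡ {a} {c} a≡c =
    trans (cong (F n (m ∸ c) c y +_) (spikesAt-multiplicity L n m y c R))
          (sym (+-assoc (F n (m ∸ c) c y) (multiplicity c L * F n (m ∸ c) c y) R))

  -- Σ_{c ∈ L} [c ≤ m] F n (m - c) c y, added to R: the coefficient of x^{n+1} q^m in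
  -- Σ_{c ∈ L} x q^c 𝔽_{c,y}(x)
  spikeSum : List ℕ → ℕ → ℕ → ℕ → ℕ → ℕ
  spikeSum L n m y R = foldr (λ c acc → (if leq c m then F n (m ∸ c) c y else 0) + acc) R L

  sumBelow-spikesAt : ∀ L n m y g → sumBelow (suc m) (λ a → spikesAt L n m y a (g a)) ≡ spikeSum L n m y (sumBelow (suc m) g)
  sumBelow-spikesAt []      n m y g = refl
  sumBelow-spikesAt (c ∷ L) n m y g =
    trans (sumBelow-indicator (suc m) c (F n (m ∸ c) c y) (λ a → spikesAt L n m y a (g a)))
          (cong ((if leq c m then F n (m ∸ c) c y else 0) +_) (sumBelow-spikesAt L n m y g))

  -- The spike relation: if the check succeeds, then  𝔽_{y,z} = Σ_{c ∈ L} x q^c 𝔽_{c,y} + 𝔽_{y′,z′}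
  -- on all coefficients of xⁿ⁺¹ (those of x⁰ agree trivially).
  spike-relation : ∀ y z L y′ z′ → spikeCheck y z L y′ z′ ≡ true →
                   ∀ n m → F (suc n) m y z ≡ spikeSum L n m y (F (suc n) m y′ z′)
  spike-relation y z L y′ z′ check n m =
    trans (sumBelow-cong (suc m) (λ a _ → trans (spikeOK⇒ n m y z L y′ z′ a (spikeCheck⇒spikeOK y z L y′ z′ check a))
                                                (sym (spikesAt-multiplicity L n m y a _))))
          (sumBelow-spikesAt L n m y (λ a → if fits a y′ z′ then F n (m ∸ a) a y′ else 0))

module Series where
  open Counting using (F; ∧-split; ≡ᵇ-true⇒≡)
  open import Data.Nat as ℕ using (ℕ; zero; suc; _≡ᵇ_)
  import Data.Nat.Properties as ℕ using (*-distribˡ-+)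
  open import Data.Integer using (ℤ; +_; -[1+_]; _+_; _*_; _-_)
  open import Data.Integer.Properties using (+-identityˡ; +-assoc; *-assoc; *-zeroʳ; *-distribˡ-+; pos-*)
  open import Data.Integer.Tactic.RingSolver using (solve-∀)
  open import Data.Bool using (Bool; true; false; _∧_; if_then_else_)
  open import Data.Product using (_×_; _,_; proj₁; proj₂)
  open import Data.List using (List; []; _∷_; _++_)
  open import Relation.Binary.PropositionalEquality

  -- coefficients of the series 𝔽_{y,z}(x, q) = Σ F n m y z xⁿ qᵐ, extended by 0 to ℤ × ℤ
  Fℤ : ℕ → ℕ → ℤ → ℤ → ℤ
  Fℤ y z (+ n)      (+ m)      = + F n m y z
  Fℤ y z (+ n)      -[1+ _ ]   = + 0
  Fℤ y z -[1+ _ ]   _          = + 0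

  -- The atom (a , b , j , y , z) stands for the series  x^a q^b 𝔽_{y,z}(x q^{3j}).
  Atom : Set
  Atom = ℕ × ℕ × ℕ × ℕ × ℕ

  coeff : Atom → ℤ → ℤ → ℤ
  coeff (a , b , j , y , z) N M = Fℤ y z (N - + a) ((M - + b) - + (3 ℕ.* j) * (N - + a))

  Expr : Set
  Expr = List (ℤ × Atom)

  ev : Expr → ℤ → ℤ → ℤ
  ev []            N M = + 0
  ev ((c , k) ∷ e) N M = c * coeff k N M + ev e N M

  Vanishes : Expr → Set
  Vanishes e = ∀ N M → ev e N M ≡ + 0

  ev-++ : ∀ e e′ N M → ev (e ++ e′) N M ≡ ev e N M + ev e′ N M
  ev-++ []            e′ N M = sym (+-identityˡ _)
  ev-++ ((c , k) ∷ e) e′ N M =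
    trans (cong (_+_ (c * coeff k N M)) (ev-++ e e′ N M)) (sym (+-assoc (c * coeff k N M) (ev e N M) (ev e′ N M)))

  ++-vanishes : ∀ e e′ → Vanishes e → Vanishes e′ → Vanishes (e ++ e′)
  ++-vanishes e e′ v v′ N M = trans (ev-++ e e′ N M) (cong₂ _+_ (v N M) (v′ N M))

  -- An operator is a finite sum of terms c x^a q^b σ^j, written (c , a , b , j),
  -- where σ is the substitution x ↦ x q³.
  Operator : Set
  Operator = List (ℤ × ℕ × ℕ × ℕ)

  _x^_q^_σ^_ : ℤ → ℕ → ℕ → ℕ → ℤ × ℕ × ℕ × ℕ
  c x^ a q^ b σ^ j = c , a , b , j
  infix 6 _x^_q^_σ^_

  -- x^a q^b σ^j  applied to  x^a′ q^b′ 𝔽(x q^{3j′})  is  x^{a+a′} q^{b+b′+3ja′} 𝔽(x q^{3(j+j′)})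
  actAtom : ℕ → ℕ → ℕ → Atom → Atom
  actAtom a b j (a′ , b′ , j′ , y , z) = (a ℕ.+ a′ , b ℕ.+ b′ ℕ.+ 3 ℕ.* j ℕ.* a′ , j ℕ.+ j′ , y , z)

  actTerm : ℤ → ℕ → ℕ → ℕ → Expr → Expr
  actTerm c a b j []             = []
  actTerm c a b j ((c′ , k) ∷ e) = (c * c′ , actAtom a b j k) ∷ actTerm c a b j e

  act : Operator → Expr → Expr
  act []                  e = []
  act ((c , a , b , j) ∷ o) e = actTerm c a b j e ++ act o e

  coeff-actAtom : ∀ a b j k N M → coeff (actAtom a b j k) N M ≡ coeff k (N - + a) ((M - + b) - + (3 ℕ.* j) * (N - + a))
  coeff-actAtom a b j (a′ , b′ , j′ , y , z) N M = cong₂ (Fℤ y z) (regroupN N (+ a) (+ a′)) regroupedM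
    where
    regroupN : ∀ N A A′ → N - (A + A′) ≡ (N - A) - A′
    regroupN = solve-∀
    regroupM : ∀ M N A A′ B B′ P P′ →
               (M - (B + B′ + P * A′)) - (P + P′) * (N - (A + A′)) ≡ (((M - B) - P * (N - A)) - B′) - P′ * ((N - A) - A′)
    regroupM = solve-∀
    regroupedM : (M - + (b ℕ.+ b′ ℕ.+ 3 ℕ.* j ℕ.* a′)) - + (3 ℕ.* (j ℕ.+ j′)) * (N - + (a ℕ.+ a′))
                 ≡ (((M - + b) - + (3 ℕ.* j) * (N - + a)) - + b′) - + (3 ℕ.* j′) * ((N - + a) - + a′)
    regroupedM = trans (cong₂ (λ u v → (M - u) - v * (N - + (a ℕ.+ a′)))
                              (cong (λ x → + b + + b′ + x) (pos-* (3 ℕ.* j) a′))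
                              (cong +_ (ℕ.*-distribˡ-+ 3 j j′)))
                       (regroupM M N (+ a) (+ a′) (+ b) (+ b′) (+ (3 ℕ.* j)) (+ (3 ℕ.* j′)))

  ev-actTerm : ∀ c a b j e N M → ev (actTerm c a b j e) N M ≡ c * ev e (N - + a) ((M - + b) - + (3 ℕ.* j) * (N - + a))
  ev-actTerm c a b j []             N M = sym (*-zeroʳ c)
  ev-actTerm c a b j ((c′ , k) ∷ e) N M =
    trans (cong₂ _+_ (trans (cong ((c * c′) *_) (coeff-actAtom a b j k N M)) (*-assoc c c′ _)) (ev-actTerm c a b j e N M))
          (sym (*-distribˡ-+ c _ _))

  act-vanishes : ∀ o e → Vanishes e → Vanishes (act o e)
  act-vanishes []                    e v N M = refl
  act-vanishes ((c , a , b , j) ∷ o) e v N M = begin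
      ev (actTerm c a b j e ++ act o e) N M             ≡⟨ ev-++ (actTerm c a b j e) (act o e) N M ⟩
      ev (actTerm c a b j e) N M + ev (act o e) N M     ≡⟨ cong₂ _+_ (ev-actTerm c a b j e N M) (act-vanishes o e v N M) ⟩
      c * ev e _ _ + + 0                                 ≡⟨ cong (λ x → c * x + + 0) (v _ _) ⟩
      c * + 0 + + 0                                      ≡⟨ cong (_+ + 0) (*-zeroʳ c) ⟩
      + 0                                                ∎
    where open ≡-Reasoning

  _≡ᵃ_ : Atom → Atom → Bool
  (a , b , j , y , z) ≡ᵃ (a′ , b′ , j′ , y′ , z′) =
    (a ≡ᵇ a′) ∧ ((b ≡ᵇ b′) ∧ ((j ≡ᵇ j′) ∧ ((y ≡ᵇ y′) ∧ (z ≡ᵇ z′))))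

  ≡ᵃ⇒≡ : ∀ k k′ → (k ≡ᵃ k′) ≡ true → k ≡ k′
  ≡ᵃ⇒≡ (a , b , j , y , z) (a′ , b′ , j′ , y′ , z′) p
    with ∧-split (a ≡ᵇ a′) p
  ... | a≡ , p₁ with ∧-split (b ≡ᵇ b′) p₁
  ... | b≡ , p₂ with ∧-split (j ≡ᵇ j′) p₂
  ... | j≡ , p₃ with ∧-split (y ≡ᵇ y′) p₃
  ... | y≡ , z≡ =
    cong₂ _,_ (≡ᵇ-true⇒≡ a≡) (cong₂ _,_ (≡ᵇ-true⇒≡ b≡)
              (cong₂ _,_ (≡ᵇ-true⇒≡ j≡) (cong₂ _,_ (≡ᵇ-true⇒≡ y≡) (≡ᵇ-true⇒≡ z≡))))

  merge : ∀ c s v r → c * v + (s * v + r) ≡ (c + s) * v + r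
  merge = solve-∀

  collect : Atom → Expr → ℤ × Expr
  collect k []             = + 0 , []
  collect k ((c , k′) ∷ e) =
    if k ≡ᵃ k′ then (c + proj₁ (collect k e) , proj₂ (collect k e))
               else (proj₁ (collect k e) , (c , k′) ∷ proj₂ (collect k e))

  collect-ev : ∀ k e N M → ev e N M ≡ proj₁ (collect k e) * coeff k N M + ev (proj₂ (collect k e)) N M
  collect-ev k []             N M = refl
  collect-ev k ((c , k′) ∷ e) N M with k ≡ᵃ k′ in same
  ... | true rewrite ≡ᵃ⇒≡ k k′ same =
    trans (cong (_+_ (c * coeff k′ N M)) (collect-ev k′ e N M))
          (merge c (proj₁ (collect k′ e)) (coeff k′ N M) (ev (proj₂ (collect k′ e)) N M))
  ... | false =
    trans (cong (_+_ (c * coeff k′ N M)) (collect-ev k e N M))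
          (swap (c * coeff k′ N M) (proj₁ (collect k e) * coeff k N M) (ev (proj₂ (collect k e)) N M))
    where
    swap : ∀ a b c → a + (b + c) ≡ b + (a + c)
    swap = solve-∀

  isZero : ℤ → Bool
  isZero (+ zero) = true
  isZero _        = false

  isZero⇒≡0 : ∀ c → isZero c ≡ true → c ≡ + 0
  isZero⇒≡0 (+ zero) _ = refl

  -- The cancellation test: the coefficients of all terms with the atom of the first term
  -- sum to 0, and the remaining terms cancel in turn; fuel bounds the number of rounds.
  cancels : ℕ → Expr → Bool
  cancels fuel       []            = true
  cancels zero       (_ ∷ _)       = false
  cancels (suc fuel) ((c , k) ∷ e) = isZero (c + proj₁ (collect k e)) ∧ cancels fuel (proj₂ (collect k e))

  cancels⇒vanishes : ∀ fuel e → cancels fuel e ≡ true → Vanishes e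
  cancels⇒vanishes fuel       []            _ N M = refl
  cancels⇒vanishes (suc fuel) ((c , k) ∷ e) p N M with ∧-split (isZero (c + proj₁ (collect k e))) p
  ... | total≡0 , rest = begin
      c * coeff k N M + ev e N M
        ≡⟨ cong (_+_ (c * coeff k N M)) (collect-ev k e N M) ⟩
      c * coeff k N M + (proj₁ (collect k e) * coeff k N M + ev (proj₂ (collect k e)) N M)
        ≡⟨ merge c (proj₁ (collect k e)) (coeff k N M) _ ⟩
      (c + proj₁ (collect k e)) * coeff k N M + ev (proj₂ (collect k e)) N M
        ≡⟨ cong₂ (λ s r → s * coeff k N M + r)
                 (isZero⇒≡0 _ total≡0) (cancels⇒vanishes fuel (proj₂ (collect k e)) rest N M) ⟩
      + 0 ∎
    where open ≡-Reasoning

module Identities where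
  open Counting
  open Relations
  open Series
  open import Data.Nat as ℕ using (ℕ; zero; suc; _∸_; _<_)
  import Data.Nat.Properties as ℕ using (≤-<-connex; m+[n∸m]≡n; m>n⇒m∸n≢0)
  open import Data.Integer using (ℤ; +_; -[1+_]; _+_; _*_; _-_; 1ℤ; -1ℤ)
  open import Data.Integer.Properties using (+-identityˡ; +-identityʳ; +-inverseʳ; +-comm; pos-*; [+m]-[+n]≡m⊖n; ⊖-≥; ⊖-<)
  open import Data.Integer.Tactic.RingSolver using (solve-∀)
  open import Data.Bool using (Bool; true; if_then_else_)
  open import Data.List using (List; []; _∷_; _++_; map; foldr)
  open import Data.Product using (_,_)
  open import Data.Sum using (inj₁; inj₂)
  open import Data.Empty using (⊥-elim)
  open import Relation.Binary.PropositionalEquality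

  Fℤ-sub : ∀ y z n m c → Fℤ y z (+ n) (+ m - + c) ≡ + (if leq c m then F n (m ∸ c) y z else 0)
  Fℤ-sub y z n m c rewrite [+m]-[+n]≡m⊖n m c with ℕ.≤-<-connex c m
  ... | inj₁ c≤m rewrite ⊖-≥ c≤m | ≤⇒leq c≤m = refl
  ... | inj₂ m<c rewrite ⊖-< m<c | >⇒leq-false m<c with c ∸ m | ℕ.m>n⇒m∸n≢0 m<c
  ...   | zero  | c∸m≢0 = ⊥-elim (c∸m≢0 refl)
  ...   | suc _ | _     = refl

  Fℤ-negative-sub : ∀ y z n k c → Fℤ y z (+ n) (-[1+ k ] - + c) ≡ + 0
  Fℤ-negative-sub y z n k zero    = refl
  Fℤ-negative-sub y z n k (suc c) = refl

  plain : ℕ → ℕ → Atom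
  plain y z = 0 , 0 , 0 , y , z

  spikeAtom : ℕ → ℕ → Atom
  spikeAtom y c = 1 , c , 0 , c , y

  coeff-plain : ∀ y z N M → coeff (plain y z) N M ≡ Fℤ y z N M
  coeff-plain y z N M = cong₂ (Fℤ y z) (+-identityʳ N) (trans (+-identityʳ (M - + 0)) (+-identityʳ M))

  coeff-spikeAtom : ∀ y c N M → coeff (spikeAtom y c) N M ≡ Fℤ c y (N - + 1) (M - + c)
  coeff-spikeAtom y c N M = cong (Fℤ c y (N - + 1)) (+-identityʳ (M - + c))

  spikeSumℤ : List ℕ → ℕ → ℤ → ℤ → ℤ → ℤ
  spikeSumℤ L y N M R = foldr (λ c acc → Fℤ c y (N - + 1) (M - + c) + acc) R L

  spikeSumℤ-idle : ∀ L y N M R → (∀ c → Fℤ c y (N - + 1) (M - + c) ≡ + 0) → spikeSumℤ L y N M R ≡ R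
  spikeSumℤ-idle []      y N M R idle = refl
  spikeSumℤ-idle (c ∷ L) y N M R idle =
    trans (cong (_+ spikeSumℤ L y N M R) (idle c)) (trans (+-identityˡ _) (spikeSumℤ-idle L y N M R idle))

  spikeSumℤ-ℕ : ∀ L y n m R → spikeSumℤ L y (+ suc n) (+ m) (+ R) ≡ + spikeSum L n m y R
  spikeSumℤ-ℕ []      y n m R = refl
  spikeSumℤ-ℕ (c ∷ L) y n m R = cong₂ _+_ (Fℤ-sub c y n m c) (spikeSumℤ-ℕ L y n m R)

  F-zero-parts : ∀ m y z y′ z′ → F zero m y z ≡ F zero m y′ z′
  F-zero-parts zero    y z y′ z′ = refl
  F-zero-parts (suc m) y z y′ z′ = refl

  spike-relationℤ : ∀ y z L y′ z′ → spikeCheck y z L y′ z′ ≡ true →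
                    ∀ N M → Fℤ y z N M ≡ spikeSumℤ L y N M (Fℤ y′ z′ N M)
  spike-relationℤ y z L y′ z′ check -[1+ k ] M =
    sym (spikeSumℤ-idle L y -[1+ k ] M (Fℤ y′ z′ -[1+ k ] M) (λ c → refl))
  spike-relationℤ y z L y′ z′ check (+ zero) (+ m) =
    trans (cong +_ (F-zero-parts m y z y′ z′)) (sym (spikeSumℤ-idle L y (+ 0) (+ m) (+ F zero m y′ z′) (λ c → refl)))
  spike-relationℤ y z L y′ z′ check (+ zero) -[1+ k ] =
    sym (spikeSumℤ-idle L y (+ 0) -[1+ k ] (+ 0) (λ c → refl))
  spike-relationℤ y z L y′ z′ check (+ suc n) (+ m) =
    trans (cong +_ (spike-relation y z L y′ z′ check n m)) (sym (spikeSumℤ-ℕ L y n m (F (suc n) m y′ z′)))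
  spike-relationℤ y z L y′ z′ check (+ suc n) -[1+ k ] =
    sym (spikeSumℤ-idle L y (+ suc n) -[1+ k ] (+ 0) (λ c → Fℤ-negative-sub c y n k c))

  F-raised : ∀ n m y z → F n m (3 ℕ.+ y) (3 ℕ.+ z) ≡ (if leq (3 ℕ.* n) m then F n (m ∸ 3 ℕ.* n) y z else 0)
  F-raised n m y z with ℕ.≤-<-connex (3 ℕ.* n) m
  ... | inj₁ 3n≤m rewrite ≤⇒leq 3n≤m = begin
      F n m (3 ℕ.+ y) (3 ℕ.+ z)                          ≡⟨ cong (λ k → F n k (3 ℕ.+ y) (3 ℕ.+ z)) (sym (ℕ.m+[n∸m]≡n 3n≤m)) ⟩
      F n (3 ℕ.* n ℕ.+ r) (3 ℕ.+ y) (3 ℕ.+ z)            ≡⟨ cong (λ t → F n (t ℕ.+ r) (3 ℕ.+ y) (3 ℕ.+ z)) (sym (triple≡3* n)) ⟩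
      F n (triple n ℕ.+ r) (3 ℕ.+ y) (3 ℕ.+ z)           ≡⟨ F-shift n r y z ⟩
      F n r y z                                          ∎
    where
    open ≡-Reasoning
    r : ℕ
    r = m ∸ 3 ℕ.* n
  ... | inj₂ m<3n rewrite >⇒leq-false m<3n = F-below n m (3 ℕ.+ y) (3 ℕ.+ z) (subst (m <_) (sym (triple≡3* n)) m<3n)

  shift-relationℤ : ∀ y z N M → Fℤ (3 ℕ.+ y) (3 ℕ.+ z) N M ≡ Fℤ y z N (M - + 3 * N)
  shift-relationℤ y z -[1+ k ] M          = refl
  shift-relationℤ y z (+ n)    (+ m)      = begin
      + F n m (3 ℕ.+ y) (3 ℕ.+ z)                              ≡⟨ cong +_ (F-raised n m y z) ⟩
      + (if leq (3 ℕ.* n) m then F n (m ∸ 3 ℕ.* n) y z else 0) ≡⟨ sym (Fℤ-sub y z n m (3 ℕ.* n)) ⟩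
      Fℤ y z (+ n) (+ m - + (3 ℕ.* n))                         ≡⟨ cong (λ u → Fℤ y z (+ n) (+ m - u)) (pos-* 3 n) ⟩
      Fℤ y z (+ n) (+ m - + 3 * + n)                           ∎
    where open ≡-Reasoning
  shift-relationℤ y z (+ n)    -[1+ k ]   =
    sym (trans (cong (λ u → Fℤ y z (+ n) (-[1+ k ] - u)) (sym (pos-* 3 n))) (Fℤ-negative-sub y z n k (3 ℕ.* n)))

  data Relation : Set where
    -- 𝔽_{y,z}(x) = Σ_{c ∈ L} x q^c 𝔽_{c,y}(x) + 𝔽_{y′,z′}(x), valid when the spike check succeeds
    spike : (y z : ℕ) (L : List ℕ) (y′ z′ : ℕ) → Relation
    -- 𝔽_{y+3,z+3}(x) = 𝔽_{y,z}(x q³)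
    shift : (y z : ℕ) → Relation

  certified : Relation → Bool
  certified (spike y z L y′ z′) = spikeCheck y z L y′ z′
  certified (shift y z)         = true

  minusRhs : List ℕ → ℕ → ℕ → ℕ → Expr
  minusRhs L y y′ z′ = map (λ c → -1ℤ , spikeAtom y c) L ++ (-1ℤ , plain y′ z′) ∷ []

  shiftedAtom : ℕ → ℕ → Atom
  shiftedAtom y z = 0 , 0 , 1 , y , z

  coeff-shiftedAtom : ∀ y z N M → coeff (shiftedAtom y z) N M ≡ Fℤ y z N (M - + 3 * N)
  coeff-shiftedAtom y z N M = cong₂ (Fℤ y z) (+-identityʳ N) (cong₂ (λ u v → u - + 3 * v) (+-identityʳ M) (+-identityʳ N))

  relationExpr : Relation → Expr
  relationExpr (spike y z L y′ z′) = (1ℤ , plain y z) ∷ minusRhs L y y′ z′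
  relationExpr (shift y z)         = (1ℤ , plain (3 ℕ.+ y) (3 ℕ.+ z)) ∷ (-1ℤ , shiftedAtom y z) ∷ []

  spike-rhs-cancels : ∀ L y y′ z′ N M →
    ev (minusRhs L y y′ z′) N M + spikeSumℤ L y N M (Fℤ y′ z′ N M) ≡ + 0
  spike-rhs-cancels []      y y′ z′ N M =
    trans (cong (λ v → -1ℤ * v + + 0 + Fℤ y′ z′ N M) (coeff-plain y′ z′ N M)) (cancel (Fℤ y′ z′ N M))
    where
    cancel : ∀ v → -1ℤ * v + + 0 + v ≡ + 0
    cancel = solve-∀
  spike-rhs-cancels (c ∷ L) y y′ z′ N M =
    trans (cong (λ v → (-1ℤ * v + rest) + (Fℤ c y (N - + 1) (M - + c) + spikeSumℤ L y N M (Fℤ y′ z′ N M)))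
                (coeff-spikeAtom y c N M))
          (trans (cancel (Fℤ c y (N - + 1) (M - + c)) rest (spikeSumℤ L y N M (Fℤ y′ z′ N M)))
                 (spike-rhs-cancels L y y′ z′ N M))
    where
    rest : ℤ
    rest = ev (minusRhs L y y′ z′) N M
    cancel : ∀ v r s → (-1ℤ * v + r) + (v + s) ≡ r + s
    cancel = solve-∀

  certified⇒vanishes : ∀ r → certified r ≡ true → Vanishes (relationExpr r)
  certified⇒vanishes (spike y z L y′ z′) check N M = begin
      1ℤ * coeff (plain y z) N M + rest         ≡⟨ cong (_+ rest) (one* (coeff (plain y z) N M)) ⟩
      coeff (plain y z) N M + rest              ≡⟨ cong (_+ rest) (coeff-plain y z N M) ⟩
      Fℤ y z N M + rest                         ≡⟨ cong (_+ rest) (spike-relationℤ y z L y′ z′ check N M) ⟩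
      spikeSumℤ L y N M (Fℤ y′ z′ N M) + rest   ≡⟨ +-comm (spikeSumℤ L y N M (Fℤ y′ z′ N M)) rest ⟩
      rest + spikeSumℤ L y N M (Fℤ y′ z′ N M)   ≡⟨ spike-rhs-cancels L y y′ z′ N M ⟩
      + 0                                       ∎
    where
    open ≡-Reasoning
    rest : ℤ
    rest = ev (minusRhs L y y′ z′) N M
    one* : ∀ v → 1ℤ * v ≡ v
    one* = solve-∀
  certified⇒vanishes (shift y z) _ N M = begin
      1ℤ * coeff raised N M + (-1ℤ * coeff (shiftedAtom y z) N M + + 0)
        ≡⟨ difference (coeff raised N M) (coeff (shiftedAtom y z) N M) ⟩
      coeff raised N M - coeff (shiftedAtom y z) N M
        ≡⟨ cong₂ _-_ (coeff-plain (3 ℕ.+ y) (3 ℕ.+ z) N M) (coeff-shiftedAtom y z N M) ⟩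
      Fℤ (3 ℕ.+ y) (3 ℕ.+ z) N M - Fℤ y z N (M - + 3 * N)
        ≡⟨ cong (_- Fℤ y z N (M - + 3 * N)) (shift-relationℤ y z N M) ⟩
      Fℤ y z N (M - + 3 * N) - Fℤ y z N (M - + 3 * N)
        ≡⟨ +-inverseʳ (Fℤ y z N (M - + 3 * N)) ⟩
      + 0 ∎
    where
    open ≡-Reasoning
    raised : Atom
    raised = plain (3 ℕ.+ y) (3 ℕ.+ z)
    difference : ∀ a b → 1ℤ * a + (-1ℤ * b + + 0) ≡ a - b
    difference = solve-∀

module Certificate where
  open Series
  open Identities
  open import Defs using (Poly; p₀; p₃; p₆; p₉)
  open import Data.Nat as ℕ using (ℕ)
  open import Data.Integer using (+_; _+_; 1ℤ; -1ℤ)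
  open import Data.Integer.Properties using (+-identityʳ)
  open import Data.Bool using (Bool; true; _∧_)
  open import Data.List using (List; []; _∷_; _++_; length)
  open import Data.Product using (_×_; _,_)
  open import Relation.Binary.PropositionalEquality
  open Counting using (∧-split)

  -- x^a q^b G(x q^{3k}), after x ↦ x q³, is x^a q^{b+3a} 𝔽_{2,1}(x q^{3k}), since G(x) = 𝔽_{2,1}(x q⁻³);
  -- this turns p(x, q) G(x q^{3k}) into atoms
  polyAtoms : Poly → ℕ → Expr
  polyAtoms []                k = []
  polyAtoms ((c , a , b) ∷ p) k = (c , a , b ℕ.+ 3 ℕ.* a , k , 2 , 1) ∷ polyAtoms p k

  -- p₀ G(x) + p₃ G(xq³) + p₆ G(xq⁶) + p₉ G(xq⁹), after x ↦ x q³
  target : Expr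
  target = polyAtoms p₀ 0 ++ (polyAtoms p₃ 1 ++ (polyAtoms p₆ 2 ++ polyAtoms p₉ 3))

  combination : List (Relation × Operator) → Expr
  combination []             = []
  combination ((r , o) ∷ cs) = act o (relationExpr r) ++ combination cs

  allCertified : List (Relation × Operator) → Bool
  allCertified []             = true
  allCertified ((r , _) ∷ cs) = certified r ∧ allCertified cs

  combination-vanishes : ∀ cs → allCertified cs ≡ true → Vanishes (combination cs)
  combination-vanishes []             _   = λ N M → refl
  combination-vanishes ((r , o) ∷ cs) all =
    let (r-ok , rest) = ∧-split (certified r) all
    in ++-vanishes (act o (relationExpr r)) (combination cs)
                   (act-vanishes o (relationExpr r) (certified⇒vanishes r r-ok))
                   (combination-vanishes cs rest)

  -- Eighteen relations with their operator multipliers, chosen so that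
  -- target + combination certificate cancels term by term.
  certificate : List (Relation × Operator)
  certificate =
      (spike 2 1 (4 ∷ []) 2 2 ,
        -1ℤ x^ 0 q^ 0 σ^ 0 ∷  1ℤ x^ 0 q^ 0 σ^ 1 ∷  1ℤ x^ 1 q^ 4 σ^ 1 ∷  1ℤ x^ 1 q^ 5 σ^ 1
      ∷  1ℤ x^ 1 q^ 6 σ^ 1 ∷ -1ℤ x^ 1 q^ 7 σ^ 0 ∷  1ℤ x^ 1 q^ 7 σ^ 1 ∷ -1ℤ x^ 1 q^ 11 σ^ 0
      ∷  1ℤ x^ 1 q^ 11 σ^ 1 ∷  1ℤ x^ 2 q^ 10 σ^ 1 ∷ + 2 x^ 2 q^ 11 σ^ 1 ∷  1ℤ x^ 2 q^ 12 σ^ 1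
      ∷  1ℤ x^ 2 q^ 14 σ^ 1 ∷  1ℤ x^ 2 q^ 15 σ^ 1 ∷  1ℤ x^ 2 q^ 16 σ^ 1 ∷  1ℤ x^ 2 q^ 17 σ^ 1
      ∷  1ℤ x^ 3 q^ 18 σ^ 1 ∷  1ℤ x^ 3 q^ 21 σ^ 1 ∷  1ℤ x^ 3 q^ 21 σ^ 2 ∷  1ℤ x^ 3 q^ 22 σ^ 1
      ∷ -1ℤ x^ 3 q^ 22 σ^ 2 ∷ -1ℤ x^ 3 q^ 23 σ^ 2 ∷ -1ℤ x^ 3 q^ 24 σ^ 2 ∷  1ℤ x^ 3 q^ 25 σ^ 1
      ∷  1ℤ x^ 4 q^ 25 σ^ 2 ∷ -1ℤ x^ 4 q^ 27 σ^ 2 ∷ -1ℤ x^ 4 q^ 28 σ^ 2 ∷ -1ℤ x^ 4 q^ 31 σ^ 2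
      ∷ -1ℤ x^ 4 q^ 32 σ^ 2 ∷ -1ℤ x^ 4 q^ 33 σ^ 2 ∷ -1ℤ x^ 4 q^ 34 σ^ 2 ∷ -1ℤ x^ 5 q^ 38 σ^ 2
      ∷ -1ℤ x^ 5 q^ 42 σ^ 2 ∷ -1ℤ x^ 5 q^ 44 σ^ 3 ∷ -1ℤ x^ 6 q^ 48 σ^ 3 ∷ -1ℤ x^ 6 q^ 52 σ^ 3
      ∷ [])
    ∷ (spike 3 2 (5 ∷ []) 3 3 ,
        -1ℤ x^ 2 q^ 11 σ^ 1 ∷ -1ℤ x^ 3 q^ 18 σ^ 1 ∷ -1ℤ x^ 3 q^ 22 σ^ 1 ∷ -1ℤ x^ 4 q^ 30 σ^ 2
      ∷  1ℤ x^ 4 q^ 31 σ^ 2 ∷ -1ℤ x^ 5 q^ 34 σ^ 2 ∷  1ℤ x^ 5 q^ 42 σ^ 2 ∷  1ℤ x^ 6 q^ 56 σ^ 3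
      ∷  1ℤ x^ 7 q^ 60 σ^ 3 ∷  1ℤ x^ 7 q^ 64 σ^ 3
      ∷ [])
    ∷ (shift 0 0 ,
        -1ℤ x^ 0 q^ 0 σ^ 0 ∷ -1ℤ x^ 1 q^ 7 σ^ 0 ∷ -1ℤ x^ 1 q^ 11 σ^ 0 ∷ -1ℤ x^ 2 q^ 13 σ^ 1
      ∷  1ℤ x^ 2 q^ 14 σ^ 1 ∷ -1ℤ x^ 3 q^ 17 σ^ 1 ∷  1ℤ x^ 3 q^ 25 σ^ 1 ∷  1ℤ x^ 4 q^ 33 σ^ 2
      ∷  1ℤ x^ 5 q^ 37 σ^ 2 ∷  1ℤ x^ 5 q^ 41 σ^ 2
      ∷ [])
    ∷ (shift 2 0 ,
        -1ℤ x^ 2 q^ 14 σ^ 1 ∷ -1ℤ x^ 3 q^ 18 σ^ 1 ∷ -1ℤ x^ 3 q^ 19 σ^ 1 ∷ -1ℤ x^ 3 q^ 21 σ^ 1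
      ∷ -1ℤ x^ 3 q^ 25 σ^ 1 ∷ -1ℤ x^ 4 q^ 25 σ^ 1 ∷ -1ℤ x^ 4 q^ 26 σ^ 1 ∷ -1ℤ x^ 4 q^ 29 σ^ 1
      ∷ -1ℤ x^ 4 q^ 30 σ^ 1 ∷  1ℤ x^ 4 q^ 34 σ^ 2 ∷  1ℤ x^ 5 q^ 38 σ^ 2 ∷  1ℤ x^ 5 q^ 42 σ^ 2
      ∷  1ℤ x^ 5 q^ 44 σ^ 2 ∷  1ℤ x^ 5 q^ 45 σ^ 2 ∷  1ℤ x^ 6 q^ 48 σ^ 2 ∷  1ℤ x^ 6 q^ 49 σ^ 2
      ∷  1ℤ x^ 6 q^ 52 σ^ 2 ∷  1ℤ x^ 6 q^ 53 σ^ 2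
      ∷ [])
    ∷ (spike 2 0 (3 ∷ 4 ∷ []) 2 2 ,
        -1ℤ x^ 2 q^ 14 σ^ 2 ∷ -1ℤ x^ 3 q^ 18 σ^ 2 ∷ -1ℤ x^ 3 q^ 19 σ^ 2 ∷ -1ℤ x^ 3 q^ 21 σ^ 2
      ∷ -1ℤ x^ 3 q^ 25 σ^ 2 ∷ -1ℤ x^ 4 q^ 25 σ^ 2 ∷ -1ℤ x^ 4 q^ 26 σ^ 2 ∷ -1ℤ x^ 4 q^ 29 σ^ 2
      ∷ -1ℤ x^ 4 q^ 30 σ^ 2 ∷  1ℤ x^ 4 q^ 34 σ^ 3 ∷  1ℤ x^ 5 q^ 38 σ^ 3 ∷  1ℤ x^ 5 q^ 42 σ^ 3
      ∷  1ℤ x^ 5 q^ 44 σ^ 3 ∷  1ℤ x^ 5 q^ 45 σ^ 3 ∷  1ℤ x^ 6 q^ 48 σ^ 3 ∷  1ℤ x^ 6 q^ 49 σ^ 3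
      ∷  1ℤ x^ 6 q^ 52 σ^ 3 ∷  1ℤ x^ 6 q^ 53 σ^ 3
      ∷ [])
    ∷ (spike 3 1 (5 ∷ []) 3 3 ,
        -1ℤ x^ 2 q^ 10 σ^ 1 ∷ -1ℤ x^ 3 q^ 17 σ^ 1 ∷ -1ℤ x^ 3 q^ 21 σ^ 1 ∷  1ℤ x^ 3 q^ 22 σ^ 2
      ∷  1ℤ x^ 4 q^ 26 σ^ 2 ∷  1ℤ x^ 4 q^ 27 σ^ 2 ∷  1ℤ x^ 4 q^ 30 σ^ 2 ∷  1ℤ x^ 4 q^ 33 σ^ 2
      ∷  1ℤ x^ 5 q^ 34 σ^ 2 ∷  1ℤ x^ 5 q^ 37 σ^ 2 ∷  1ℤ x^ 5 q^ 38 σ^ 2 ∷  1ℤ x^ 5 q^ 41 σ^ 2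
      ∷ -1ℤ x^ 5 q^ 45 σ^ 3 ∷ -1ℤ x^ 6 q^ 49 σ^ 3 ∷ -1ℤ x^ 6 q^ 53 σ^ 3 ∷ -1ℤ x^ 6 q^ 56 σ^ 3
      ∷ -1ℤ x^ 7 q^ 60 σ^ 3 ∷ -1ℤ x^ 7 q^ 64 σ^ 3
      ∷ [])
    ∷ (spike 4 2 (6 ∷ []) 4 4 ,
        -1ℤ x^ 1 q^ 4 σ^ 0 ∷  1ℤ x^ 1 q^ 7 σ^ 1 ∷ -1ℤ x^ 2 q^ 11 σ^ 0 ∷  1ℤ x^ 2 q^ 11 σ^ 1
      ∷  1ℤ x^ 2 q^ 13 σ^ 1 ∷  1ℤ x^ 2 q^ 14 σ^ 1 ∷ -1ℤ x^ 2 q^ 15 σ^ 0 ∷  1ℤ x^ 2 q^ 18 σ^ 1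
      ∷  1ℤ x^ 3 q^ 17 σ^ 1 ∷ + 2 x^ 3 q^ 18 σ^ 1 ∷  1ℤ x^ 3 q^ 21 σ^ 1 ∷  1ℤ x^ 3 q^ 22 σ^ 1
      ∷  1ℤ x^ 3 q^ 24 σ^ 1 ∷  1ℤ x^ 4 q^ 25 σ^ 1 ∷  1ℤ x^ 4 q^ 28 σ^ 1 ∷  1ℤ x^ 4 q^ 29 σ^ 1
      ∷  1ℤ x^ 4 q^ 32 σ^ 1 ∷ -1ℤ x^ 4 q^ 33 σ^ 2 ∷ -1ℤ x^ 4 q^ 34 σ^ 2 ∷ -1ℤ x^ 5 q^ 37 σ^ 2
      ∷ -1ℤ x^ 5 q^ 38 σ^ 2 ∷ -1ℤ x^ 5 q^ 41 σ^ 2 ∷ -1ℤ x^ 5 q^ 42 σ^ 2 ∷ -1ℤ x^ 5 q^ 44 σ^ 2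
      ∷ -1ℤ x^ 6 q^ 48 σ^ 2 ∷ -1ℤ x^ 6 q^ 52 σ^ 2
      ∷ [])
    ∷ (shift 1 1 ,
        -1ℤ x^ 1 q^ 4 σ^ 0 ∷ -1ℤ x^ 2 q^ 11 σ^ 0 ∷  1ℤ x^ 2 q^ 13 σ^ 1 ∷ -1ℤ x^ 2 q^ 14 σ^ 1
      ∷ -1ℤ x^ 2 q^ 15 σ^ 0 ∷  1ℤ x^ 3 q^ 17 σ^ 1 ∷  1ℤ x^ 3 q^ 24 σ^ 1 ∷ -1ℤ x^ 3 q^ 25 σ^ 1
      ∷  1ℤ x^ 4 q^ 28 σ^ 1 ∷  1ℤ x^ 4 q^ 32 σ^ 1 ∷ -1ℤ x^ 4 q^ 33 σ^ 2 ∷ -1ℤ x^ 5 q^ 37 σ^ 2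
      ∷ -1ℤ x^ 5 q^ 41 σ^ 2
      ∷ [])
    ∷ (shift 3 1 ,
        -1ℤ x^ 2 q^ 10 σ^ 0 ∷ -1ℤ x^ 3 q^ 17 σ^ 0 ∷ -1ℤ x^ 3 q^ 21 σ^ 0 ∷  1ℤ x^ 3 q^ 22 σ^ 1
      ∷  1ℤ x^ 4 q^ 26 σ^ 1 ∷  1ℤ x^ 4 q^ 27 σ^ 1 ∷  1ℤ x^ 4 q^ 30 σ^ 1 ∷  1ℤ x^ 4 q^ 33 σ^ 1
      ∷  1ℤ x^ 5 q^ 34 σ^ 1 ∷  1ℤ x^ 5 q^ 37 σ^ 1 ∷  1ℤ x^ 5 q^ 38 σ^ 1 ∷  1ℤ x^ 5 q^ 41 σ^ 1
      ∷ -1ℤ x^ 5 q^ 45 σ^ 2 ∷ -1ℤ x^ 6 q^ 49 σ^ 2 ∷ -1ℤ x^ 6 q^ 53 σ^ 2 ∷ -1ℤ x^ 6 q^ 56 σ^ 2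
      ∷ -1ℤ x^ 7 q^ 60 σ^ 2 ∷ -1ℤ x^ 7 q^ 64 σ^ 2
      ∷ [])
    ∷ (spike 0 0 (3 ∷ []) 1 1 ,
        -1ℤ x^ 0 q^ 0 σ^ 1 ∷ -1ℤ x^ 1 q^ 7 σ^ 1 ∷ -1ℤ x^ 1 q^ 11 σ^ 1 ∷ -1ℤ x^ 2 q^ 13 σ^ 2
      ∷  1ℤ x^ 2 q^ 14 σ^ 2 ∷ -1ℤ x^ 3 q^ 17 σ^ 2 ∷  1ℤ x^ 3 q^ 25 σ^ 2 ∷  1ℤ x^ 4 q^ 33 σ^ 3
      ∷  1ℤ x^ 5 q^ 37 σ^ 3 ∷  1ℤ x^ 5 q^ 41 σ^ 3
      ∷ [])
    ∷ (spike 3 0 (5 ∷ []) 3 3 ,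
        -1ℤ x^ 1 q^ 6 σ^ 1 ∷ -1ℤ x^ 2 q^ 13 σ^ 1 ∷ -1ℤ x^ 2 q^ 17 σ^ 1 ∷ -1ℤ x^ 3 q^ 22 σ^ 2
      ∷  1ℤ x^ 3 q^ 23 σ^ 2 ∷ -1ℤ x^ 4 q^ 26 σ^ 2 ∷  1ℤ x^ 4 q^ 34 σ^ 2 ∷  1ℤ x^ 5 q^ 45 σ^ 3
      ∷  1ℤ x^ 6 q^ 49 σ^ 3 ∷  1ℤ x^ 6 q^ 53 σ^ 3
      ∷ [])
    ∷ (spike 1 1 (4 ∷ []) 2 2 ,
        -1ℤ x^ 0 q^ 0 σ^ 1 ∷ -1ℤ x^ 1 q^ 4 σ^ 1 ∷ -1ℤ x^ 1 q^ 7 σ^ 1 ∷ -1ℤ x^ 1 q^ 11 σ^ 1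
      ∷ -1ℤ x^ 2 q^ 11 σ^ 1 ∷ -1ℤ x^ 2 q^ 15 σ^ 1 ∷  1ℤ x^ 3 q^ 24 σ^ 2 ∷  1ℤ x^ 4 q^ 28 σ^ 2
      ∷  1ℤ x^ 4 q^ 32 σ^ 2
      ∷ [])
    ∷ (spike 4 1 (4 ∷ 6 ∷ []) 4 4 ,
        -1ℤ x^ 1 q^ 7 σ^ 1 ∷ -1ℤ x^ 2 q^ 11 σ^ 1 ∷ -1ℤ x^ 2 q^ 14 σ^ 1 ∷ -1ℤ x^ 2 q^ 18 σ^ 1
      ∷ -1ℤ x^ 3 q^ 18 σ^ 1 ∷ -1ℤ x^ 3 q^ 22 σ^ 1 ∷  1ℤ x^ 4 q^ 34 σ^ 2 ∷  1ℤ x^ 5 q^ 38 σ^ 2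
      ∷  1ℤ x^ 5 q^ 42 σ^ 2
      ∷ [])
    ∷ (spike 2 2 (5 ∷ []) 3 3 ,
        -1ℤ x^ 0 q^ 0 σ^ 0 ∷  1ℤ x^ 1 q^ 6 σ^ 1 ∷ -1ℤ x^ 1 q^ 7 σ^ 0 ∷ -1ℤ x^ 1 q^ 11 σ^ 0
      ∷  1ℤ x^ 2 q^ 10 σ^ 1 ∷  1ℤ x^ 2 q^ 11 σ^ 1 ∷  1ℤ x^ 2 q^ 14 σ^ 1 ∷  1ℤ x^ 2 q^ 17 σ^ 1
      ∷  1ℤ x^ 3 q^ 18 σ^ 1 ∷  1ℤ x^ 3 q^ 21 σ^ 1 ∷  1ℤ x^ 3 q^ 22 σ^ 1 ∷ -1ℤ x^ 3 q^ 23 σ^ 2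
      ∷  1ℤ x^ 3 q^ 25 σ^ 1 ∷ -1ℤ x^ 4 q^ 27 σ^ 2 ∷ -1ℤ x^ 4 q^ 31 σ^ 2 ∷ -1ℤ x^ 4 q^ 34 σ^ 2
      ∷ -1ℤ x^ 5 q^ 38 σ^ 2 ∷ -1ℤ x^ 5 q^ 42 σ^ 2
      ∷ [])
    ∷ (spike 5 2 (6 ∷ 7 ∷ []) 5 5 ,
        -1ℤ x^ 1 q^ 5 σ^ 0 ∷ -1ℤ x^ 2 q^ 12 σ^ 0 ∷  1ℤ x^ 2 q^ 14 σ^ 1 ∷ -1ℤ x^ 2 q^ 16 σ^ 0
      ∷  1ℤ x^ 3 q^ 18 σ^ 1 ∷  1ℤ x^ 3 q^ 19 σ^ 1 ∷  1ℤ x^ 3 q^ 22 σ^ 1 ∷  1ℤ x^ 3 q^ 25 σ^ 1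
      ∷  1ℤ x^ 4 q^ 26 σ^ 1 ∷  1ℤ x^ 4 q^ 29 σ^ 1 ∷  1ℤ x^ 4 q^ 30 σ^ 1 ∷  1ℤ x^ 4 q^ 33 σ^ 1
      ∷ -1ℤ x^ 4 q^ 34 σ^ 2 ∷ -1ℤ x^ 5 q^ 38 σ^ 2 ∷ -1ℤ x^ 5 q^ 42 σ^ 2 ∷ -1ℤ x^ 5 q^ 45 σ^ 2
      ∷ -1ℤ x^ 6 q^ 49 σ^ 2 ∷ -1ℤ x^ 6 q^ 53 σ^ 2
      ∷ [])
    ∷ (shift 3 2 ,
        -1ℤ x^ 2 q^ 11 σ^ 0 ∷ -1ℤ x^ 3 q^ 18 σ^ 0 ∷ -1ℤ x^ 3 q^ 22 σ^ 0 ∷  1ℤ x^ 3 q^ 23 σ^ 1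
      ∷  1ℤ x^ 4 q^ 27 σ^ 1 ∷  1ℤ x^ 4 q^ 28 σ^ 1 ∷  1ℤ x^ 4 q^ 31 σ^ 1 ∷  1ℤ x^ 4 q^ 34 σ^ 1
      ∷  1ℤ x^ 5 q^ 35 σ^ 1 ∷  1ℤ x^ 5 q^ 38 σ^ 1 ∷  1ℤ x^ 5 q^ 39 σ^ 1 ∷  1ℤ x^ 5 q^ 42 σ^ 1
      ∷ -1ℤ x^ 5 q^ 46 σ^ 2 ∷ -1ℤ x^ 6 q^ 50 σ^ 2 ∷ -1ℤ x^ 6 q^ 54 σ^ 2 ∷ -1ℤ x^ 6 q^ 57 σ^ 2
      ∷ -1ℤ x^ 7 q^ 61 σ^ 2 ∷ -1ℤ x^ 7 q^ 65 σ^ 2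
      ∷ [])
    ∷ (shift 4 2 ,
        -1ℤ x^ 2 q^ 12 σ^ 0 ∷ -1ℤ x^ 3 q^ 19 σ^ 0 ∷ -1ℤ x^ 3 q^ 23 σ^ 0 ∷  1ℤ x^ 3 q^ 24 σ^ 1
      ∷  1ℤ x^ 4 q^ 28 σ^ 1 ∷  1ℤ x^ 4 q^ 29 σ^ 1 ∷  1ℤ x^ 4 q^ 32 σ^ 1 ∷  1ℤ x^ 4 q^ 35 σ^ 1
      ∷  1ℤ x^ 5 q^ 36 σ^ 1 ∷  1ℤ x^ 5 q^ 39 σ^ 1 ∷  1ℤ x^ 5 q^ 40 σ^ 1 ∷  1ℤ x^ 5 q^ 43 σ^ 1
      ∷ -1ℤ x^ 5 q^ 47 σ^ 2 ∷ -1ℤ x^ 6 q^ 51 σ^ 2 ∷ -1ℤ x^ 6 q^ 55 σ^ 2 ∷ -1ℤ x^ 6 q^ 58 σ^ 2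
      ∷ -1ℤ x^ 7 q^ 62 σ^ 2 ∷ -1ℤ x^ 7 q^ 66 σ^ 2
      ∷ [])
    ∷ (shift 2 2 ,
        -1ℤ x^ 1 q^ 5 σ^ 0 ∷ -1ℤ x^ 2 q^ 12 σ^ 0 ∷  1ℤ x^ 2 q^ 14 σ^ 1 ∷ -1ℤ x^ 2 q^ 16 σ^ 0
      ∷  1ℤ x^ 3 q^ 18 σ^ 1 ∷  1ℤ x^ 3 q^ 19 σ^ 1 ∷  1ℤ x^ 3 q^ 22 σ^ 1 ∷  1ℤ x^ 3 q^ 25 σ^ 1
      ∷  1ℤ x^ 4 q^ 26 σ^ 1 ∷  1ℤ x^ 4 q^ 29 σ^ 1 ∷  1ℤ x^ 4 q^ 30 σ^ 1 ∷  1ℤ x^ 4 q^ 33 σ^ 1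
      ∷ -1ℤ x^ 4 q^ 34 σ^ 2 ∷ -1ℤ x^ 5 q^ 38 σ^ 2 ∷ -1ℤ x^ 5 q^ 42 σ^ 2 ∷ -1ℤ x^ 5 q^ 45 σ^ 2
      ∷ -1ℤ x^ 6 q^ 49 σ^ 2 ∷ -1ℤ x^ 6 q^ 53 σ^ 2
      ∷ [])
    ∷ []

  certificate-certified : allCertified certificate ≡ true
  certificate-certified = refl

  -- target + combination cancels term by term (each round of `cancels` removes a term,
  -- so the length is enough fuel)
  whole : Expr
  whole = target ++ combination certificate

  whole-cancels : cancels (length whole) whole ≡ true
  whole-cancels = refl

  target-vanishes : Vanishes target
  target-vanishes N M = begin
      ev target N M                                     ≡⟨ sym (+-identityʳ _) ⟩
      ev target N M + + 0                               ≡⟨ cong (_+_ (ev target N M)) (sym combination≡0) ⟩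
      ev target N M + ev (combination certificate) N M  ≡⟨ sym (ev-++ target (combination certificate) N M) ⟩
      ev whole N M                                      ≡⟨ cancels⇒vanishes (length whole) whole whole-cancels N M ⟩
      + 0                                               ∎
    where
    open ≡-Reasoning
    combination≡0 : ev (combination certificate) N M ≡ + 0
    combination≡0 = combination-vanishes certificate certificate-certified N M

module Coefficients where
  open import Defs using (g; gShift; coeffMul; lhsCoeff; Poly; p₀; p₃; p₆; p₉)
  open Counting using (F; triple≡3*)
  open Enumeration using (g≡F)
  open Series
  open Certificate using (polyAtoms; target)
  open import Data.Nat as ℕ using (ℕ; zero; suc; _∸_; _≤_; _<_; _≤?_)
  import Data.Nat.Properties as ℕ using (+-comm; ≤-<-connex; ∸-monoʳ-<; m>n⇒m∸n≢0; ≰⇒>; m∸n+n≡m)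
  open import Data.Integer using (ℤ; +_; -[1+_]; _+_; _*_; _-_)
  open import Data.Integer.Properties using (+-identityˡ; *-zeroʳ; pos-*; [+m]-[+n]≡m⊖n; ⊖-≥; ⊖-<)
  open import Data.Integer.Tactic.RingSolver using (solve-∀)
  open import Data.Product using (Σ-syntax; _,_)
  open import Data.List using (List; []; _∷_; _++_)
  open import Data.Sum using (inj₁; inj₂)
  open import Data.Empty using (⊥-elim)
  open import Relation.Nullary using (yes; no)
  open import Relation.Binary.PropositionalEquality

  gℤ : ℕ → ℤ → ℤ
  gℤ i (+ x)      = + g i x
  gℤ i -[1+ _ ]   = + 0

  gℤ-negative : ∀ i d q → gℤ i (-[1+ d ] - + q) ≡ + 0
  gℤ-negative i d zero    = refl
  gℤ-negative i d (suc q) = refl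

  −-negative : ∀ m n → m < n → Σ[ d ∈ ℕ ] (+ m - + n ≡ -[1+ d ])
  −-negative m n m<n rewrite [+m]-[+n]≡m⊖n m n | ⊖-< m<n with n ∸ m | ℕ.m>n⇒m∸n≢0 m<n
  ... | zero  | n∸m≢0 = ⊥-elim (n∸m≢0 refl)
  ... | suc d | _     = d , refl

  −-natural : ∀ {m n} → n ≤ m → + m - + n ≡ + (m ∸ n)
  −-natural {m} {n} n≤m = trans ([+m]-[+n]≡m⊖n m n) (⊖-≥ n≤m)

  Fℤ-G : ∀ i X → Fℤ 2 1 (+ i) (X + + (3 ℕ.* i)) ≡ gℤ i X
  Fℤ-G i (+ x) = cong +_ (begin
      F i (x ℕ.+ 3 ℕ.* i) 2 1            ≡⟨ cong (λ u → F i u 2 1) (ℕ.+-comm x (3 ℕ.* i)) ⟩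
      F i (3 ℕ.* i ℕ.+ x) 2 1            ≡⟨ cong (λ t → F i (t ℕ.+ x) 2 1) (sym (triple≡3* i)) ⟩
      F i (Counting.triple i ℕ.+ x) 2 1  ≡⟨ sym (g≡F i x) ⟩
      g i x                              ∎)
    where open ≡-Reasoning
  Fℤ-G i -[1+ k ] with ℕ.≤-<-connex (suc k) (3 ℕ.* i)
  ... | inj₁ k<3i rewrite ⊖-≥ k<3i =
    cong +_ (Counting.F-below i (3 ℕ.* i ∸ suc k) 2 1
               (subst (3 ℕ.* i ∸ suc k <_) (sym (triple≡3* i)) (ℕ.∸-monoʳ-< {3 ℕ.* i} {suc k} {0} (ℕ.s≤s ℕ.z≤n) k<3i)))
  ... | inj₂ 3i≤k rewrite ⊖-< 3i≤k with suc k ∸ 3 ℕ.* i | ℕ.m>n⇒m∸n≢0 3i≤k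
  ...   | zero  | k∸3i≢0 = ⊥-elim (k∸3i≢0 refl)
  ...   | suc _ | _      = refl

  gShift≡gℤ : ∀ K i j → gShift K i j ≡ gℤ i (+ j - + (K ℕ.* i))
  gShift≡gℤ K i j with K ℕ.* i ≤? j
  ... | yes Ki≤j rewrite −-natural Ki≤j = refl
  ... | no  Ki≰j with −-negative j (K ℕ.* i) (ℕ.≰⇒> Ki≰j)
  ...   | d , j−Ki≡ rewrite j−Ki≡ = refl

  coeff-polyAtom : ∀ a b k n m → a ≤ n →
                   coeff (a , b ℕ.+ 3 ℕ.* a , k , 2 , 1) (+ n) (+ (3 ℕ.* n ℕ.+ m))
                   ≡ gℤ (n ∸ a) ((+ m - + b) - + (3 ℕ.* k ℕ.* (n ∸ a)))
  coeff-polyAtom a b k n m a≤n = begin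
      Fℤ 2 1 (+ n - + a) ((+ (3 ℕ.* n ℕ.+ m) - + (b ℕ.+ 3 ℕ.* a)) - + (3 ℕ.* k) * (+ n - + a))
        ≡⟨ cong₂ (λ u w → Fℤ 2 1 u ((+ (3 ℕ.* w ℕ.+ m) - + (b ℕ.+ 3 ℕ.* a)) - + (3 ℕ.* k) * u))
                 (−-natural a≤n) (sym (ℕ.m∸n+n≡m a≤n)) ⟩
      Fℤ 2 1 (+ i) ((+ (3 ℕ.* (i ℕ.+ a) ℕ.+ m) - + (b ℕ.+ 3 ℕ.* a)) - + (3 ℕ.* k) * + i)
        ≡⟨ cong (Fℤ 2 1 (+ i)) reindex ⟩
      Fℤ 2 1 (+ i) (((+ m - + b) - + (3 ℕ.* k ℕ.* i)) + + (3 ℕ.* i))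
        ≡⟨ Fℤ-G i _ ⟩
      gℤ i ((+ m - + b) - + (3 ℕ.* k ℕ.* i)) ∎
    where
    open ≡-Reasoning
    i : ℕ
    i = n ∸ a
    regroup : ∀ I A Mm B K → ((+ 3 * (I + A) + Mm) - (B + + 3 * A)) - K * I ≡ ((Mm - B) - K * I) + + 3 * I
    regroup = solve-∀
    reindex : (+ (3 ℕ.* (i ℕ.+ a) ℕ.+ m) - + (b ℕ.+ 3 ℕ.* a)) - + (3 ℕ.* k) * + i
              ≡ ((+ m - + b) - + (3 ℕ.* k ℕ.* i)) + + (3 ℕ.* i)
    reindex =
      trans (cong₂ (λ u v → (u + + m - v) - + (3 ℕ.* k) * + i) (pos-* 3 (i ℕ.+ a)) (cong (λ x → + b + x) (pos-* 3 a)))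
            (trans (regroup (+ i) (+ a) (+ m) (+ b) (+ (3 ℕ.* k)))
                   (cong₂ (λ u v → ((+ m - + b) - u) + v) (sym (pos-* (3 ℕ.* k) i)) (sym (pos-* 3 i))))

  drop-term : ∀ c v r → v ≡ + 0 → c * v + r ≡ r
  drop-term c v r v≡0 rewrite v≡0 | *-zeroʳ c = +-identityˡ r

  coeffMul≡ev : ∀ p k n m → coeffMul p (3 ℕ.* k) n m ≡ ev (polyAtoms p k) (+ n) (+ (3 ℕ.* n ℕ.+ m))
  coeffMul≡ev []                k n m = refl
  coeffMul≡ev ((c , a , b) ∷ p) k n m with a ≤? n | b ≤? m
  ... | yes a≤n | yes b≤m = cong₂ _+_ (cong (c *_) term) (coeffMul≡ev p k n m)
    where
    term : gShift (3 ℕ.* k) (n ∸ a) (m ∸ b) ≡ coeff (a , b ℕ.+ 3 ℕ.* a , k , 2 , 1) (+ n) (+ (3 ℕ.* n ℕ.+ m))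
    term = trans (gShift≡gℤ (3 ℕ.* k) (n ∸ a) (m ∸ b))
                 (trans (cong (λ u → gℤ (n ∸ a) (u - + (3 ℕ.* k ℕ.* (n ∸ a)))) (sym (−-natural b≤m)))
                        (sym (coeff-polyAtom a b k n m a≤n)))
  ... | yes a≤n | no b≰m = trans (coeffMul≡ev p k n m) (sym (drop-term c _ _ vanishing))
    where
    vanishing : coeff (a , b ℕ.+ 3 ℕ.* a , k , 2 , 1) (+ n) (+ (3 ℕ.* n ℕ.+ m)) ≡ + 0
    vanishing with −-negative m b (ℕ.≰⇒> b≰m)
    ... | d , m−b≡ = trans (coeff-polyAtom a b k n m a≤n)
                           (trans (cong (λ u → gℤ (n ∸ a) (u - + (3 ℕ.* k ℕ.* (n ∸ a)))) m−b≡)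
                                  (gℤ-negative (n ∸ a) d (3 ℕ.* k ℕ.* (n ∸ a))))
  ... | no a≰n | _ = trans (coeffMul≡ev p k n m) (sym (drop-term c _ _ vanishing))
    where
    vanishing : coeff (a , b ℕ.+ 3 ℕ.* a , k , 2 , 1) (+ n) (+ (3 ℕ.* n ℕ.+ m)) ≡ + 0
    vanishing with −-negative n a (ℕ.≰⇒> a≰n)
    ... | d , n−a≡ rewrite n−a≡ = refl

  lhsCoeff≡ev-target : ∀ n m → lhsCoeff n m ≡ ev target (+ n) (+ (3 ℕ.* n ℕ.+ m))
  lhsCoeff≡ev-target n m = begin
      lhsCoeff n m
        ≡⟨ cong₂ _+_ (cong₂ _+_ (cong₂ _+_ (coeffMul≡ev p₀ 0 n m) (coeffMul≡ev p₃ 1 n m)) (coeffMul≡ev p₆ 2 n m))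
                     (coeffMul≡ev p₉ 3 n m) ⟩
      ((e p₀ 0 + e p₃ 1) + e p₆ 2) + e p₉ 3
        ≡⟨ reassociate (e p₀ 0) (e p₃ 1) (e p₆ 2) (e p₉ 3) ⟩
      e p₀ 0 + (e p₃ 1 + (e p₆ 2 + e p₉ 3))
        ≡⟨ sym (trans (ev-++ (polyAtoms p₀ 0) (polyAtoms p₃ 1 ++ (polyAtoms p₆ 2 ++ polyAtoms p₉ 3)) N M)
                      (cong (_+_ (e p₀ 0)) (trans (ev-++ (polyAtoms p₃ 1) (polyAtoms p₆ 2 ++ polyAtoms p₉ 3) N M)
                                               (cong (_+_ (e p₃ 1)) (ev-++ (polyAtoms p₆ 2) (polyAtoms p₉ 3) N M))))) ⟩
      ev target N M ∎
    where
    open ≡-Reasoning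
    N M : ℤ
    N = + n
    M = + (3 ℕ.* n ℕ.+ m)
    e : Poly → ℕ → ℤ
    e p k = ev (polyAtoms p k) N M
    reassociate : ∀ a b c d → ((a + b) + c) + d ≡ a + (b + (c + d))
    reassociate = solve-∀

open import Defs using (lhsCoeff)
open import Data.Nat as ℕ using (ℕ)
open import Data.Integer using (+_)
open import Relation.Binary.PropositionalEquality using (_≡_; module ≡-Reasoning)
open Coefficients using (lhsCoeff≡ev-target)
open Certificate using (target; target-vanishes)
open Series using (ev)

mainTheorem11 : (n m : ℕ) → lhsCoeff n m ≡ + 0
mainTheorem11 n m = begin
    lhsCoeff n m                             ≡⟨ lhsCoeff≡ev-target n m ⟩
    ev target (+ n) (+ (3 ℕ.* n ℕ.+ m))      ≡⟨ target-vanishes (+ n) (+ (3 ℕ.* n ℕ.+ m)) ⟩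
    + 0                                      ∎
  where open ≡-Reasoning
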